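{- Let $q\in\{2,3\}$ and let $M$ be a $GF(q)$-comatroid. Then for every flat $F$ of $M$, the restriction $M|F$ is a $GF(q)$-comatroid.
   Context: All matroids are simple. For $q\in\{2,3\}$ every simple $GF(q)$-representable matroid $M$ is uniquely $GF(q)$-representable, so for $k\ge r(M)$ one can write $M\cong PG(k-1,q)|T$, and the $(GF(q),k)$-complement of $M$ is $PG(k-1,q)\backslash T$ (well defined up to isomorphism). $GF(q)$-comatroids are defined recursively: $U_{0,0}$ is one; the direct sum of two is one; and the $(GF(q),t)$-complement of one is one for every $t\ge r(M)$. -}

module Defs where

open import Data.Nat using (ℕ; zero; suc; _+_; _*_; _∸_; _≤_; _<_)
open import Data.Nat.Divisibility using (_∣_)
open import Data.Fin using (Fin; toℕ)
open import Data.Fin.Subset using (Subset; _∈_; _∉_; _⊆_; _∪_; ⁅_⁆; ∣_∣)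
  renaming (⊥ to ∅; ⊤ to full)
open import Data.Vec using (take; drop)
open import Data.Product using (Σ; ∃; _×_; _,_)
open import Data.Sum using (_⊎_)
open import Relation.Nullary using (¬_)
open import Relation.Binary.PropositionalEquality using (_≡_; _≢_)
open import Function.Bundles using (_⇔_)
open import Function.Definitions using (Injective)

record Matroid (n : ℕ) : Set₁ where
  field
    Ind     : Subset n → Set
    ind-∅   : Ind ∅
    ind-⊆   : ∀ {X Y} → X ⊆ Y → Ind Y → Ind X
    ind-aug : ∀ {X Y} → Ind X → Ind Y → ∣ X ∣ < ∣ Y ∣ →
              ∃ λ y → y ∈ Y × y ∉ X × Ind (⁅ y ⁆ ∪ X)
    -- simplicity: no loops and no parallel pairs
    simple  : ∀ i j → Ind (⁅ i ⁆ ∪ ⁅ j ⁆)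

open Matroid public

IsImage : ∀ {m n} → (Fin m → Fin n) → Subset m → Subset n → Set
IsImage f X Y = ∀ i → (i ∈ Y) ⇔ (∃ λ j → j ∈ X × f j ≡ i)

-- N is isomorphic to the restriction M|F (via an injection with image F)
IsRestrictionOf : ∀ {m n} → Matroid m → Matroid n → Subset n → Set
IsRestrictionOf {m} {n} N M F =
  Σ (Fin m → Fin n) λ e →
    Injective _≡_ _≡_ e ×
    (∀ i → (i ∈ F) ⇔ (∃ λ j → e j ≡ i)) ×
    (∀ X Y → IsImage e X Y → (Ind N X ⇔ Ind M Y))

_≅_ : ∀ {m n} → Matroid m → Matroid n → Set
N ≅ M = IsRestrictionOf N M full

RankIs : ∀ {n} → Matroid n → Subset n → ℕ → Set
RankIs M X r =
  (∃ λ I → I ⊆ X × Ind M I × ∣ I ∣ ≡ r) ×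
  (∀ I → I ⊆ X → Ind M I → ∣ I ∣ ≤ r)

IsFlat : ∀ {n} → Matroid n → Subset n → Set
IsFlat M F = ∀ x → x ∉ F → ∀ r → RankIs M F r → ¬ RankIs M (⁅ x ⁆ ∪ F) r

-- Linear algebra over GF(q), q prime, with elements Fin q
-- (arithmetic in ℕ, equality to zero tested by divisibility by q).

∑ : ∀ {n} → (Fin n → ℕ) → ℕ
∑ {zero}  f = 0
∑ {suc n} f = f Fin.zero + ∑ (λ i → f (Fin.suc i))
  where import Data.Fin as Fin

Vecq : ℕ → ℕ → Set
Vecq q t = Fin t → Fin q

NonzeroVec : ∀ {q t} → Vecq q t → Set
NonzeroVec v = ∃ λ j → toℕ (v j) ≢ 0

-- v = c·u for some nonzero scalar c  (q ∸ 1 ≡ -1 mod q)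
Parallel : ∀ q {t} → Vecq q t → Vecq q t → Set
Parallel q {t} u v = ∃ λ (c : Fin q) → toℕ c ≢ 0 ×
  (∀ (j : Fin t) → q ∣ (toℕ c * toℕ (u j) + (q ∸ 1) * toℕ (v j)))

Dependent : ∀ q {n t} → (Fin n → Vecq q t) → Subset n → Set
Dependent q {n} {t} e X = ∃ λ (c : Fin n → Fin q) →
  (∀ i → toℕ (c i) ≢ 0 → i ∈ X) ×
  (∃ λ i → toℕ (c i) ≢ 0) ×
  (∀ (j : Fin t) → q ∣ ∑ (λ i → toℕ (c i) * toℕ (e i j)))

Independent : ∀ q {n t} → (Fin n → Vecq q t) → Subset n → Set
Independent q e X = ¬ Dependent q e X

-- e : Fin n → GF(q)^t realises M ≅ PG(t-1,q)|T, where T is the set of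
-- projective points spanned by the e i (nonzero, pairwise non-parallel).
Represents : ∀ q {n} → Matroid n → (t : ℕ) → (Fin n → Vecq q t) → Set
Represents q {n} M t e =
  (∀ i → NonzeroVec (e i)) ×
  (∀ i j → i ≢ j → ¬ Parallel q (e i) (e j)) ×
  (∀ X → Ind M X ⇔ Independent q e X)

data IsComatroid (q : ℕ) : ∀ {n} → Matroid n → Set₁ where
  empty : (M : Matroid 0) → IsComatroid q M
  iso   : ∀ {m n} {M : Matroid m} {N : Matroid n} →
          IsComatroid q M → N ≅ M → IsComatroid q N
  dsum  : ∀ {m n} {M₁ : Matroid m} {M₂ : Matroid n} →
          IsComatroid q M₁ → IsComatroid q M₂ →
          (N : Matroid (m + n)) →
          (∀ X → Ind N X ⇔ (Ind M₁ (take m X) × Ind M₂ (drop m X))) →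
          IsComatroid q N
  -- (GF(q),t)-complement: M ≅ PG(t-1,q)|T via eM, N ≅ PG(t-1,q)\T via eN
  -- (the points of eM and eN partition the points of PG(t-1,q));
  -- such an embedding of M forces t ≥ r(M).
  compl : ∀ {m n} {M : Matroid m} →
          IsComatroid q M →
          (t : ℕ) (eM : Fin m → Vecq q t) → Represents q M t eM →
          (N : Matroid n) (eN : Fin n → Vecq q t) → Represents q N t eN →
          (∀ i j → ¬ Parallel q (eM i) (eN j)) →
          (∀ (v : Vecq q t) → NonzeroVec v →
             (∃ λ i → Parallel q (eM i) v) ⊎ (∃ λ j → Parallel q (eN j) v)) →
          IsComatroid q N

-- Induction on the derivation of IsComatroid q M.  Isomorphisms carry flats to flats and
-- restrictions to restrictions.  A flat of a direct sum is the sum of flats of the summands,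
-- and its restriction is the sum of their restrictions.  In the complement step
-- M ≅ PG(t-1,q)|T and N ≅ PG(t-1,q)\T: a basis B of a flat F of N spans a subspace V with
-- F = N ∩ V, the points G = M ∩ V form a flat of M, and in coordinates with respect to B,
-- N|F is the (GF(q),|B|)-complement of M|G, a comatroid by induction.

module Submission where

open import Defs
open import Data.Nat using (ℕ; zero; suc; _+_; _*_; _∸_; _≤_; _<_; z≤n; s≤s; NonZero; _%_)
open import Data.Nat.Properties
  using (≤-refl; ≮⇒≥; <-irrefl; n≮n; +-mono-≤; +-identityʳ; *-identityʳ; *-identityˡ; *-zeroʳ;
         *-distribˡ-+; *-assoc; +-assoc; *-comm; +-comm; m∸n+n≡m; <-≤-trans)
  renaming (_≟_ to _≟ℕ_)
open import Data.Nat.DivMod using (%-distribˡ-+; %-distribˡ-*; m%n%n≡m%n; m<n⇒m%n≡m; m%n<n; m*n%n≡0)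
open import Data.Nat.Divisibility using (_∣_; m%n≡0⇒n∣m; n∣m⇒m%n≡0)
open import Data.Nat.Tactic.RingSolver using (solve-∀)
open import Data.Bool using (true; false)
open import Data.Fin using (Fin; zero; suc; toℕ; fromℕ<; _↑ˡ_; _↑ʳ_)
open import Data.Fin.Properties using (any?; all?; toℕ-fromℕ<; toℕ<n; suc-injective) renaming (_≟_ to _≟F_)
open import Data.Fin.Subset using (Subset; _∈_; _∉_; _⊆_; _∪_; ⁅_⁆; ∣_∣) renaming (⊥ to ∅; ⊤ to full)
open import Data.Fin.Subset.Properties
  using (drop-∷-⊆; ∉⊥; ∈⊤; x∈⁅x⁆; x∈⁅y⁆⇒x≡y; x∈p∪q⁻; p⊆p∪q; q⊆p∪q; ⊆-antisym; _∈?_; ∣⊥∣≡0; ∪-identityˡ)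
open import Data.List using (List; []; _∷_; allFin)
open import Data.List.Membership.Propositional using () renaming (_∈_ to _∈L_)
open import Data.List.Membership.Propositional.Properties using (∈-allFin)
open import Data.List.Relation.Unary.Any using () renaming (here to lhere; there to lthere)
open import Data.Vec using ([]; _∷_; here; there; tabulate; take; drop; _++_)
open import Data.Vec.Properties using (take++drop≡id; ++-injective; zipWith-++; []=⇒lookup; lookup⇒[]=; lookup∘tabulate)
open import Data.Product using (Σ; ∃; _×_; _,_; proj₁; proj₂)
open import Data.Sum using (_⊎_; inj₁; inj₂)
open import Data.Empty using (⊥-elim)
open import Relation.Nullary using (¬_; Dec; yes; no; does)
open import Relation.Nullary.Decidable using (¬?; _×-dec_; _→-dec_; dec-true)
open import Relation.Binary.PropositionalEquality
  using (_≡_; _≢_; refl; sym; trans; cong; cong₂; subst; subst₂; module ≡-Reasoning)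
open import Relation.Binary.Bundles using (Setoid)
import Relation.Binary.Reasoning.Setoid as SetoidReasoning
open import Function.Bundles using (_⇔_; mk⇔; Equivalence)
open import Function.Definitions using (Injective)

open Equivalence using (to; from)

-- Subsets, images and enumerations

x≡y⇒x∈⁅y⁆ : ∀ {n} {x y : Fin n} → x ≡ y → x ∈ ⁅ y ⁆
x≡y⇒x∈⁅y⁆ {x = x} refl = x∈⁅x⁆ x

∣⁅x⁆∪p∣≡1+∣p∣ : ∀ {n} (x : Fin n) (p : Subset n) → x ∉ p → ∣ ⁅ x ⁆ ∪ p ∣ ≡ suc ∣ p ∣
∣⁅x⁆∪p∣≡1+∣p∣ zero    (false ∷ p) x∉p = cong (λ p → suc ∣ p ∣) (∪-identityˡ p)
∣⁅x⁆∪p∣≡1+∣p∣ zero    (true ∷ p)  x∉p = ⊥-elim (x∉p here)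
∣⁅x⁆∪p∣≡1+∣p∣ (suc x) (false ∷ p) x∉p = ∣⁅x⁆∪p∣≡1+∣p∣ x p (λ x∈p → x∉p (there x∈p))
∣⁅x⁆∪p∣≡1+∣p∣ (suc x) (true ∷ p)  x∉p = cong suc (∣⁅x⁆∪p∣≡1+∣p∣ x p (λ x∈p → x∉p (there x∈p)))

image : ∀ {m n} → (Fin m → Fin n) → Subset m → Subset n
image f []          = ∅
image f (true ∷ X)  = ⁅ f zero ⁆ ∪ image (λ j → f (suc j)) X
image f (false ∷ X) = image (λ j → f (suc j)) X

∈-image⁺ : ∀ {m n} (f : Fin m → Fin n) (X : Subset m) {j} → j ∈ X → f j ∈ image f X
∈-image⁺ f (true ∷ X)  here      = p⊆p∪q _ (x∈⁅x⁆ (f zero))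
∈-image⁺ f (true ∷ X)  (there p) = q⊆p∪q ⁅ f zero ⁆ _ (∈-image⁺ (λ j → f (suc j)) X p)
∈-image⁺ f (false ∷ X) (there p) = ∈-image⁺ (λ j → f (suc j)) X p

∈-image⁻ : ∀ {m n} (f : Fin m → Fin n) (X : Subset m) {i} → i ∈ image f X → ∃ λ j → j ∈ X × f j ≡ i
∈-image⁻ f []          p = ⊥-elim (∉⊥ p)
∈-image⁻ f (true ∷ X)  p with x∈p∪q⁻ ⁅ f zero ⁆ _ p
... | inj₁ q = zero , here , sym (x∈⁅y⁆⇒x≡y _ q)
... | inj₂ q with ∈-image⁻ (λ j → f (suc j)) X q
... | j , j∈X , fj≡i = suc j , there j∈X , fj≡i
∈-image⁻ f (false ∷ X) p with ∈-image⁻ (λ j → f (suc j)) X p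
... | j , j∈X , fj≡i = suc j , there j∈X , fj≡i

image-IsImage : ∀ {m n} (f : Fin m → Fin n) X → IsImage f X (image f X)
image-IsImage f X i = mk⇔ (∈-image⁻ f X) (λ { (j , j∈X , refl) → ∈-image⁺ f X j∈X })

IsImage⇒≡image : ∀ {m n} (f : Fin m → Fin n) X Y → IsImage f X Y → Y ≡ image f X
IsImage⇒≡image f X Y isImage =
  ⊆-antisym (λ {i} i∈Y → from (image-IsImage f X i) (to (isImage i) i∈Y))
            (λ {i} i∈fX → from (isImage i) (∈-image⁻ f X i∈fX))

image-unique : ∀ {m n} (f : Fin m → Fin n) X Y →
               (∀ i → i ∈ Y → ∃ λ j → j ∈ X × f j ≡ i) → (∀ j → j ∈ X → f j ∈ Y) → image f X ≡ Y
image-unique f X Y ⊆f[X] f[X]⊆ =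
  sym (IsImage⇒≡image f X Y (λ i → mk⇔ (⊆f[X] i) (λ { (j , j∈X , refl) → f[X]⊆ j j∈X })))

∣image∣≡∣X∣ : ∀ {m n} (f : Fin m → Fin n) → Injective _≡_ _≡_ f → (X : Subset m) → ∣ image f X ∣ ≡ ∣ X ∣
∣image∣≡∣X∣ {n = n} f f-inj []          = ∣⊥∣≡0 n
∣image∣≡∣X∣ f f-inj (true ∷ X)  =
  trans (∣⁅x⁆∪p∣≡1+∣p∣ (f zero) _ f0∉)
        (cong suc (∣image∣≡∣X∣ (λ j → f (suc j)) (λ e → suc-injective (f-inj e)) X))
  where
  f0∉ : f zero ∉ image (λ j → f (suc j)) X
  f0∉ p with ∈-image⁻ (λ j → f (suc j)) X p
  ... | j , _ , e with f-inj e
  ... | ()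
∣image∣≡∣X∣ f f-inj (false ∷ X) = ∣image∣≡∣X∣ (λ j → f (suc j)) (λ e → suc-injective (f-inj e)) X

image-∅ : ∀ {m n} (f : Fin m → Fin n) → image f ∅ ≡ ∅
image-∅ f = image-unique f ∅ ∅ (λ i p → ⊥-elim (∉⊥ p)) (λ j p → ⊥-elim (∉⊥ p))

image-mono : ∀ {m n} (f : Fin m → Fin n) {X Y} → X ⊆ Y → image f X ⊆ image f Y
image-mono f {X} {Y} X⊆Y p with ∈-image⁻ f X p
... | j , j∈X , refl = ∈-image⁺ f Y (X⊆Y j∈X)

image-⁅⁆∪ : ∀ {m n} (f : Fin m → Fin n) j X → image f (⁅ j ⁆ ∪ X) ≡ ⁅ f j ⁆ ∪ image f X
image-⁅⁆∪ f j X = image-unique f _ _ ⊆f[X] f[X]⊆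
  where
  ⊆f[X] : ∀ i → i ∈ ⁅ f j ⁆ ∪ image f X → ∃ λ k → k ∈ ⁅ j ⁆ ∪ X × f k ≡ i
  ⊆f[X] i p with x∈p∪q⁻ ⁅ f j ⁆ _ p
  ... | inj₁ q = j , p⊆p∪q X (x∈⁅x⁆ j) , sym (x∈⁅y⁆⇒x≡y _ q)
  ... | inj₂ q with ∈-image⁻ f X q
  ... | k , k∈X , e = k , q⊆p∪q ⁅ j ⁆ X k∈X , e
  f[X]⊆ : ∀ k → k ∈ ⁅ j ⁆ ∪ X → f k ∈ ⁅ f j ⁆ ∪ image f X
  f[X]⊆ k p with x∈p∪q⁻ ⁅ j ⁆ X p
  ... | inj₁ q = p⊆p∪q _ (x≡y⇒x∈⁅y⁆ (cong f (x∈⁅y⁆⇒x≡y _ q)))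
  ... | inj₂ q = q⊆p∪q ⁅ f j ⁆ _ (∈-image⁺ f X q)

image-⁅⁆ : ∀ {m n} (f : Fin m → Fin n) j → image f ⁅ j ⁆ ≡ ⁅ f j ⁆
image-⁅⁆ f j = image-unique f _ _ (λ i p → j , x∈⁅x⁆ j , sym (x∈⁅y⁆⇒x≡y _ p))
                                  (λ k p → x≡y⇒x∈⁅y⁆ (cong f (x∈⁅y⁆⇒x≡y _ p)))

enum : ∀ {n} (F : Subset n) → Fin ∣ F ∣ → Fin n
enum (true ∷ F)  zero    = zero
enum (true ∷ F)  (suc j) = suc (enum F j)
enum (false ∷ F) j       = suc (enum F j)

enum-injective : ∀ {n} (F : Subset n) → Injective _≡_ _≡_ (enum F)
enum-injective (true ∷ F)  {zero}  {zero}  e = refl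
enum-injective (true ∷ F)  {suc x} {suc y} e = cong suc (enum-injective F (suc-injective e))
enum-injective (false ∷ F)                 e = enum-injective F (suc-injective e)

enum-∈ : ∀ {n} (F : Subset n) j → enum F j ∈ F
enum-∈ (true ∷ F)  zero    = here
enum-∈ (true ∷ F)  (suc j) = there (enum-∈ F j)
enum-∈ (false ∷ F) j       = there (enum-∈ F j)

∈⇒∈-enum : ∀ {n} (F : Subset n) {i} → i ∈ F → ∃ λ j → enum F j ≡ i
∈⇒∈-enum (true ∷ F)  here      = zero , refl
∈⇒∈-enum (true ∷ F)  (there p) with ∈⇒∈-enum F p
... | j , e = suc j , cong suc e
∈⇒∈-enum (false ∷ F) (there p) with ∈⇒∈-enum F p
... | j , e = j , cong suc e

-- Pullbacks and restrictions of matroids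

pullback : ∀ {m n} → Matroid n → (f : Fin m → Fin n) → Injective _≡_ _≡_ f → Matroid m
pullback {m} M f f-inj = record
  { Ind     = λ X → Ind M (image f X)
  ; ind-∅   = subst (Ind M) (sym (image-∅ f)) (ind-∅ M)
  ; ind-⊆   = λ X⊆Y → ind-⊆ M (image-mono f X⊆Y)
  ; ind-aug = augment
  ; simple  = λ i j → subst (Ind M) (sym (image-pair i j)) (simple M (f i) (f j))
  }
  where
  image-pair : ∀ i j → image f (⁅ i ⁆ ∪ ⁅ j ⁆) ≡ ⁅ f i ⁆ ∪ ⁅ f j ⁆
  image-pair i j = trans (image-⁅⁆∪ f i ⁅ j ⁆) (cong (⁅ f i ⁆ ∪_) (image-⁅⁆ f j))
  augment : ∀ {X Y : Subset m} → Ind M (image f X) → Ind M (image f Y) → ∣ X ∣ < ∣ Y ∣ →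
            ∃ λ y → y ∈ Y × y ∉ X × Ind M (image f (⁅ y ⁆ ∪ X))
  augment {X} {Y} indX indY ∣X∣<∣Y∣
    with ind-aug M indX indY (subst₂ _<_ (sym (∣image∣≡∣X∣ f f-inj X)) (sym (∣image∣≡∣X∣ f f-inj Y)) ∣X∣<∣Y∣)
  ... | y , y∈fY , y∉fX , ind with ∈-image⁻ f Y y∈fY
  ... | j , j∈Y , refl =
    j , j∈Y , (λ j∈X → y∉fX (∈-image⁺ f X j∈X)) , subst (Ind M) (sym (image-⁅⁆∪ f j X)) ind

restriction : ∀ {n} → Matroid n → (F : Subset n) → Matroid ∣ F ∣
restriction M F = pullback M (enum F) (enum-injective F)

⇔-refl : ∀ {A : Set} → A ⇔ A
⇔-refl = mk⇔ (λ x → x) (λ x → x)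

pullback-IsRestrictionOf : ∀ {m n} (M : Matroid n) (f : Fin m → Fin n) (f-inj : Injective _≡_ _≡_ f) (F : Subset n) →
  (∀ i → (i ∈ F) ⇔ (∃ λ j → f j ≡ i)) → IsRestrictionOf (pullback M f f-inj) M F
pullback-IsRestrictionOf M f f-inj F F≡range = f , f-inj , F≡range , λ X Y isImage →
  subst (λ Z → Ind M (image f X) ⇔ Ind M Z) (sym (IsImage⇒≡image f X Y isImage)) ⇔-refl

restriction-IsRestrictionOf : ∀ {n} (M : Matroid n) (F : Subset n) → IsRestrictionOf (restriction M F) M F
restriction-IsRestrictionOf M F = pullback-IsRestrictionOf M (enum F) (enum-injective F) F
  (λ i → mk⇔ (∈⇒∈-enum F) (λ { (j , refl) → enum-∈ F j }))

pullback-≅ : ∀ {n n' m₁ m₂} {N : Matroid n} {M : Matroid n'} → (φ : N ≅ M) →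
  (f : Fin m₁ → Fin n) (f-inj : Injective _≡_ _≡_ f) (g : Fin m₂ → Fin n') (g-inj : Injective _≡_ _≡_ g)
  (h : Fin m₁ → Fin m₂) → (∀ j → g (h j) ≡ proj₁ φ (f j)) → (∀ j₂ → ∃ λ j₁ → h j₁ ≡ j₂) →
  pullback N f f-inj ≅ pullback M g g-inj
pullback-≅ {N = N} {M} (φ , φ-inj , _ , φ-ind) f f-inj g g-inj h g∘h≡φ∘f h-surj =
  h , h-inj , (λ i → mk⇔ (λ _ → h-surj i) (λ _ → ∈⊤)) , ind
  where
  h-inj : Injective _≡_ _≡_ h
  h-inj {x} {y} e = f-inj (φ-inj (trans (sym (g∘h≡φ∘f x)) (trans (cong g e) (g∘h≡φ∘f y))))
  ind : ∀ X Y → IsImage h X Y → Ind N (image f X) ⇔ Ind M (image g Y)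
  ind X Y Y≡h[X] = φ-ind (image f X) (image g Y) λ i → mk⇔ (⊆φ[fX] i) (φ[fX]⊆ i)
    where
    ⊆φ[fX] : ∀ i → i ∈ image g Y → ∃ λ j → j ∈ image f X × φ j ≡ i
    ⊆φ[fX] i p with ∈-image⁻ g Y p
    ... | y , y∈Y , refl with to (Y≡h[X] y) y∈Y
    ... | x , x∈X , refl = f x , ∈-image⁺ f X x∈X , sym (g∘h≡φ∘f x)
    φ[fX]⊆ : ∀ i → (∃ λ j → j ∈ image f X × φ j ≡ i) → i ∈ image g Y
    φ[fX]⊆ i (j , j∈fX , refl) with ∈-image⁻ f X j∈fX
    ... | x , x∈X , refl =
      subst (_∈ image g Y) (g∘h≡φ∘f x) (∈-image⁺ g Y (from (Y≡h[X] (h x)) (x , x∈X , refl)))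

image-id : ∀ {n} (X : Subset n) → image (λ i → i) X ≡ X
image-id X = image-unique (λ i → i) X X (λ i p → i , p , refl) (λ j p → p)

≅-refl : ∀ {n} (M : Matroid n) → M ≅ M
≅-refl M = (λ i → i) , (λ e → e) , (λ i → mk⇔ (λ _ → i , refl) (λ _ → ∈⊤)) , λ X Y isImage →
  subst (λ Z → Ind M X ⇔ Ind M Z) (sym (trans (IsImage⇒≡image (λ i → i) X Y isImage) (image-id X))) ⇔-refl

MaximalIndependentIn : ∀ {n} → Matroid n → Subset n → Subset n → Set
MaximalIndependentIn M Z B = B ⊆ Z × Ind M B × (∀ y → y ∈ Z → y ∉ B → ¬ Ind M (⁅ y ⁆ ∪ B))

maximalIndependent⇒RankIs : ∀ {n} (M : Matroid n) {Z B} → MaximalIndependentIn M Z B → RankIs M Z ∣ B ∣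
maximalIndependent⇒RankIs M {Z} {B} (B⊆Z , indB , maximal) = (B , (λ {z} → B⊆Z {z}) , indB , refl) , bound
  where
  bound : ∀ I → I ⊆ Z → Ind M I → ∣ I ∣ ≤ ∣ B ∣
  bound I I⊆Z indI = ≮⇒≥ λ ∣B∣<∣I∣ →
    let (y , y∈I , y∉B , ind) = ind-aug M indB indI ∣B∣<∣I∣ in maximal y (I⊆Z y∈I) y∉B ind

⁅y⁆∪-mono : ∀ {n} (y : Fin n) {A B : Subset n} → A ⊆ B → ⁅ y ⁆ ∪ A ⊆ ⁅ y ⁆ ∪ B
⁅y⁆∪-mono y {A} {B} A⊆B p with x∈p∪q⁻ ⁅ y ⁆ A p
... | inj₁ q = p⊆p∪q B q
... | inj₂ q = q⊆p∪q ⁅ y ⁆ B (A⊆B q)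

-- The greedy algorithm, run in a monad T: the identity monad when independence is
-- decidable, the double-negation monad in general.
module Greedy {n} (M : Matroid n) (T : Set → Set) (return : ∀ {A : Set} → A → T A)
  (_>>=_ : ∀ {A B : Set} → T A → (A → T B) → T B)
  (extendable? : ∀ B y → Ind M B → y ∉ B → T (Dec (Ind M (⁅ y ⁆ ∪ B)))) (Z : Subset n) where

  MaximalAmong : List (Fin n) → Subset n → Set
  MaximalAmong L B = B ⊆ Z × Ind M B × (∀ y → y ∈L L → y ∈ Z → y ∉ B → ¬ Ind M (⁅ y ⁆ ∪ B))

  MaximalAmong-skip : ∀ {x L B} → MaximalAmong L B → (x ∈ Z → x ∉ B → ¬ Ind M (⁅ x ⁆ ∪ B)) → MaximalAmong (x ∷ L) B
  MaximalAmong-skip (B⊆Z , indB , maximal) x-bad = (λ {z} → B⊆Z {z}) , indB , λ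
    { y (lhere refl) → x-bad
    ; y (lthere y∈L) → maximal y y∈L }

  MaximalAmong-insert : ∀ {x L B} → MaximalAmong L B → x ∈ Z → Ind M (⁅ x ⁆ ∪ B) → MaximalAmong (x ∷ L) (⁅ x ⁆ ∪ B)
  MaximalAmong-insert {x} {L} {B} (B⊆Z , _ , maximal) x∈Z ind = xB⊆Z , ind , maximal'
    where
    xB⊆Z : ⁅ x ⁆ ∪ B ⊆ Z
    xB⊆Z p with x∈p∪q⁻ ⁅ x ⁆ B p
    ... | inj₁ q = subst (_∈ Z) (sym (x∈⁅y⁆⇒x≡y x q)) x∈Z
    ... | inj₂ q = B⊆Z q
    maximal' : ∀ y → y ∈L (x ∷ L) → y ∈ Z → y ∉ ⁅ x ⁆ ∪ B → ¬ Ind M (⁅ y ⁆ ∪ (⁅ x ⁆ ∪ B))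
    maximal' y (lhere refl) _ y∉ = ⊥-elim (y∉ (p⊆p∪q B (x∈⁅x⁆ y)))
    maximal' y (lthere y∈L) y∈Z y∉ ind' =
      maximal y y∈L y∈Z (λ y∈B → y∉ (q⊆p∪q ⁅ x ⁆ B y∈B))
              (ind-⊆ M (⁅y⁆∪-mono y (q⊆p∪q ⁅ x ⁆ B)) ind')

  greedy : (L : List (Fin n)) → T (Σ (Subset n) (MaximalAmong L))
  greedy []      = return (∅ , (λ {_} p → ⊥-elim (∉⊥ p)) , ind-∅ M , λ y ())
  greedy (x ∷ L) = greedy L >>= step
    where
    step : Σ (Subset n) (MaximalAmong L) → T (Σ (Subset n) (MaximalAmong (x ∷ L)))
    step (B , maxB) with x ∈? Z | x ∈? B
    ... | no x∉Z   | _       = return (B , MaximalAmong-skip maxB (λ x∈Z → ⊥-elim (x∉Z x∈Z)))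
    ... | yes _    | yes x∈B = return (B , MaximalAmong-skip maxB (λ _ x∉B → ⊥-elim (x∉B x∈B)))
    ... | yes x∈Z  | no x∉B  = extendable? B x (proj₁ (proj₂ maxB)) x∉B >>= λ
      { (no ¬ind) → return (B , MaximalAmong-skip maxB (λ _ _ → ¬ind))
      ; (yes ind) → return (⁅ x ⁆ ∪ B , MaximalAmong-insert maxB x∈Z ind) }

  maximalIndependent : T (Σ (Subset n) (MaximalIndependentIn M Z))
  maximalIndependent = greedy (allFin n) >>= λ
    { (B , B⊆Z , indB , maximal) → return (B , (λ {z} → B⊆Z {z}) , indB , λ y → maximal y (∈-allFin y)) }

¬¬_ : Set → Set
¬¬ A = ¬ ¬ A

¬¬-rank : ∀ {n} (M : Matroid n) (Z : Subset n) → ¬¬ (∃ λ r → RankIs M Z r)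
¬¬-rank M Z k = maximalIndependent (λ { (B , maxB) → k (∣ B ∣ , maximalIndependent⇒RankIs M maxB) })
  where
  open Greedy M ¬¬_ (λ a k → k a) (λ ma f k → ma (λ a → f a k)) (λ B y _ _ k → k (no (λ i → k (yes i)))) Z

-- Transport along isomorphisms

subset : ∀ {n} {P : Fin n → Set} → (∀ i → Dec (P i)) → Subset n
subset P? = tabulate (λ i → does (P? i))

∈-subset⁺ : ∀ {n} {P : Fin n → Set} (P? : ∀ i → Dec (P i)) {i} → P i → i ∈ subset P?
∈-subset⁺ P? {i} p = lookup⇒[]= i _ (trans (lookup∘tabulate _ i) (dec-true (P? i) p))

∈-subset⁻ : ∀ {n} {P : Fin n → Set} (P? : ∀ i → Dec (P i)) {i} → i ∈ subset P? → P i
∈-subset⁻ P? {i} i∈ = does-true (P? i) (trans (sym (lookup∘tabulate _ i)) ([]=⇒lookup i∈))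
  where
  does-true : ∀ {A : Set} (a? : Dec A) → does a? ≡ true → A
  does-true (yes a) _ = a

preimage : ∀ {m n} → (Fin m → Fin n) → Subset n → Subset m
preimage φ I = subset (λ j → φ j ∈? I)

module Transport {n n'} {N : Matroid n} {M : Matroid n'} (iso : N ≅ M) where

  φ : Fin n → Fin n'
  φ = proj₁ iso

  φ-injective : Injective _≡_ _≡_ φ
  φ-injective = proj₁ (proj₂ iso)

  φ-surjective : ∀ i → ∃ λ j → φ j ≡ i
  φ-surjective i = to (proj₁ (proj₂ (proj₂ iso)) i) ∈⊤

  Ind-image : ∀ X → Ind N X ⇔ Ind M (image φ X)
  Ind-image X = proj₂ (proj₂ (proj₂ iso)) X (image φ X) (image-IsImage φ X)

  image-preimage : ∀ I → image φ (preimage φ I) ≡ I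
  image-preimage I = image-unique φ (preimage φ I) I ⊆φ[pre] (λ j p → ∈-subset⁻ (λ j → φ j ∈? I) p)
    where
    ⊆φ[pre] : ∀ i → i ∈ I → ∃ λ j → j ∈ preimage φ I × φ j ≡ i
    ⊆φ[pre] i i∈I with φ-surjective i
    ... | j , refl = j , ∈-subset⁺ (λ j → φ j ∈? I) i∈I , refl

  RankIs-image⁻ : ∀ {Z r} → RankIs M (image φ Z) r → RankIs N Z r
  RankIs-image⁻ {Z} {r} ((I , I⊆φZ , indI , ∣I∣≡r) , bound) = (preimage φ I , J⊆Z , indJ , ∣J∣≡r) , bound'
    where
    J⊆Z : preimage φ I ⊆ Z
    J⊆Z p with ∈-image⁻ φ Z (I⊆φZ (∈-subset⁻ (λ j → φ j ∈? I) p))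
    ... | j , j∈Z , e = subst (_∈ Z) (φ-injective e) j∈Z
    indJ : Ind N (preimage φ I)
    indJ = from (Ind-image (preimage φ I)) (subst (Ind M) (sym (image-preimage I)) indI)
    ∣J∣≡r : ∣ preimage φ I ∣ ≡ r
    ∣J∣≡r = trans (sym (∣image∣≡∣X∣ φ φ-injective (preimage φ I)))
                  (trans (cong ∣_∣ (image-preimage I)) ∣I∣≡r)
    bound' : ∀ J → J ⊆ Z → Ind N J → ∣ J ∣ ≤ r
    bound' J J⊆Z indJ' =
      subst (_≤ r) (∣image∣≡∣X∣ φ φ-injective J) (bound (image φ J) (image-mono φ J⊆Z) (to (Ind-image J) indJ'))

  IsFlat-image : ∀ {F} → IsFlat N F → IsFlat M (image φ F)
  IsFlat-image {F} flat x x∉φF r rank rank' with φ-surjective x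
  ... | y , refl = flat y (λ y∈F → x∉φF (∈-image⁺ φ F y∈F)) r (RankIs-image⁻ rank)
                        (RankIs-image⁻ (subst (λ Z → RankIs M Z r) (sym (image-⁅⁆∪ φ y F)) rank'))

  restriction-≅ : ∀ F → restriction N F ≅ restriction M (image φ F)
  restriction-≅ F =
    pullback-≅ {N = N} {M = M} iso (enum F) (enum-injective F) (enum φF) (enum-injective φF) h g∘h≡φ∘f h-surj
    where
    φF : Subset n'
    φF = image φ F
    lift : ∀ j → ∃ λ j' → enum φF j' ≡ φ (enum F j)
    lift j = ∈⇒∈-enum φF (∈-image⁺ φ F (enum-∈ F j))
    h : Fin ∣ F ∣ → Fin ∣ φF ∣
    h j = proj₁ (lift j)
    g∘h≡φ∘f : ∀ j → enum φF (h j) ≡ φ (enum F j)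
    g∘h≡φ∘f j = proj₂ (lift j)
    h-surj : ∀ j₂ → ∃ λ j₁ → h j₁ ≡ j₂
    h-surj j₂ with ∈-image⁻ φ F (enum-∈ φF j₂)
    ... | y , y∈F , φy≡ with ∈⇒∈-enum F y∈F
    ... | j₁ , refl = j₁ , enum-injective φF (trans (g∘h≡φ∘f j₁) φy≡)

-- Direct sums

take-++ : ∀ {a b} (A : Subset a) (B : Subset b) → take a (A ++ B) ≡ A
take-++ {a} A B = proj₁ (++-injective (take a (A ++ B)) A (take++drop≡id a (A ++ B)))

drop-++ : ∀ {a b} (A : Subset a) (B : Subset b) → drop a (A ++ B) ≡ B
drop-++ {a} A B = proj₂ (++-injective (take a (A ++ B)) A (take++drop≡id a (A ++ B)))

++-⊆ : ∀ {a b} {A A' : Subset a} {B B' : Subset b} → A ⊆ A' → B ⊆ B' → A ++ B ⊆ A' ++ B'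
++-⊆ {A = []}    {[]}     A⊆A' B⊆B' p         = B⊆B' p
++-⊆ {A = _ ∷ A} {_ ∷ A'} A⊆A' B⊆B' here      with A⊆A' here
... | here = here
++-⊆ {A = _ ∷ A} {_ ∷ A'} A⊆A' B⊆B' (there p) = there (++-⊆ {A = A} {A'} (drop-∷-⊆ A⊆A') B⊆B' p)

++-⊆⁻ : ∀ {a b} {A A' : Subset a} {B B' : Subset b} → A ++ B ⊆ A' ++ B' → A ⊆ A' × B ⊆ B'
++-⊆⁻ {A = []}    {[]}     AB⊆ = (λ ()) , AB⊆
++-⊆⁻ {A = _ ∷ A} {_ ∷ A'} AB⊆ with ++-⊆⁻ {A = A} {A'} (drop-∷-⊆ AB⊆)
... | A⊆A' , B⊆B' = head∷A⊆ , B⊆B'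
  where
  head∷A⊆ : _ ⊆ _
  head∷A⊆ here      with AB⊆ here
  ... | here = here
  head∷A⊆ (there q) = there (A⊆A' q)

∣++∣ : ∀ {a b} (A : Subset a) (B : Subset b) → ∣ A ++ B ∣ ≡ ∣ A ∣ + ∣ B ∣
∣++∣ []          B = refl
∣++∣ (true ∷ A)  B = cong suc (∣++∣ A B)
∣++∣ (false ∷ A) B = ∣++∣ A B

∅-++ : ∀ a b → ∅ {a + b} ≡ ∅ {a} ++ ∅ {b}
∅-++ zero    b = refl
∅-++ (suc a) b = cong (false ∷_) (∅-++ a b)

full-++ : ∀ a b → full {a + b} ≡ full {a} ++ full {b}
full-++ zero    b = refl
full-++ (suc a) b = cong (true ∷_) (full-++ a b)

⁅↑ˡ⁆∪-++ : ∀ {a b} (x : Fin a) (A : Subset a) (B : Subset b) → ⁅ x ↑ˡ b ⁆ ∪ (A ++ B) ≡ (⁅ x ⁆ ∪ A) ++ B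
⁅↑ˡ⁆∪-++ {b = b} zero    (_ ∷ A) B = cong (true ∷_) (trans (cong (_∪ (A ++ B)) (∅-++ _ b))
                                                (trans (zipWith-++ _ ∅ ∅ A B) (cong (∅ ∪ A ++_) (∪-identityˡ B))))
⁅↑ˡ⁆∪-++ (suc x) (_ ∷ A) B = cong (_ ∷_) (⁅↑ˡ⁆∪-++ x A B)

⁅↑ʳ⁆∪-++ : ∀ {a b} (y : Fin b) (A : Subset a) (B : Subset b) → ⁅ a ↑ʳ y ⁆ ∪ (A ++ B) ≡ A ++ (⁅ y ⁆ ∪ B)
⁅↑ʳ⁆∪-++ y []      B = refl
⁅↑ʳ⁆∪-++ y (_ ∷ A) B = cong (_ ∷_) (⁅↑ʳ⁆∪-++ y A B)

↑ˡ∈-++⁻ : ∀ {a b} (A : Subset a) (B : Subset b) x → x ↑ˡ b ∈ A ++ B → x ∈ A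
↑ˡ∈-++⁻ (true ∷ A) B zero    here      = here
↑ˡ∈-++⁻ (_ ∷ A)    B (suc x) (there p) = there (↑ˡ∈-++⁻ A B x p)

↑ʳ∈-++⁻ : ∀ {a b} (A : Subset a) (B : Subset b) y → a ↑ʳ y ∈ A ++ B → y ∈ B
↑ʳ∈-++⁻ []      B y p         = p
↑ʳ∈-++⁻ (_ ∷ A) B y (there p) = ↑ʳ∈-++⁻ A B y p

enum-++ : ∀ {a b} (F₁ : Subset a) (F₂ : Subset b) → Fin (∣ F₁ ∣ + ∣ F₂ ∣) → Fin (a + b)
enum-++ []          F₂ j       = enum F₂ j
enum-++ (true ∷ F₁)  F₂ zero    = zero
enum-++ (true ∷ F₁)  F₂ (suc j) = suc (enum-++ F₁ F₂ j)
enum-++ (false ∷ F₁) F₂ j       = suc (enum-++ F₁ F₂ j)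

enum-++-injective : ∀ {a b} (F₁ : Subset a) (F₂ : Subset b) → Injective _≡_ _≡_ (enum-++ F₁ F₂)
enum-++-injective []           F₂ e = enum-injective F₂ e
enum-++-injective (true ∷ F₁)  F₂ {zero}  {zero}  e = refl
enum-++-injective (true ∷ F₁)  F₂ {suc x} {suc y} e = cong suc (enum-++-injective F₁ F₂ (suc-injective e))
enum-++-injective (false ∷ F₁) F₂ e = enum-++-injective F₁ F₂ (suc-injective e)

image-suc : ∀ {m n} (f : Fin m → Fin n) X → image (λ j → suc (f j)) X ≡ false ∷ image f X
image-suc f []          = refl
image-suc f (true ∷ X)  = cong (⁅ suc (f zero) ⁆ ∪_) (image-suc (λ j → f (suc j)) X)
image-suc f (false ∷ X) = image-suc (λ j → f (suc j)) X

image-enum-++ : ∀ {a b} (F₁ : Subset a) (F₂ : Subset b) (X₁ : Subset ∣ F₁ ∣) (X₂ : Subset ∣ F₂ ∣) →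
  image (enum-++ F₁ F₂) (X₁ ++ X₂) ≡ image (enum F₁) X₁ ++ image (enum F₂) X₂
image-enum-++ []           F₂ []          X₂ = refl
image-enum-++ (true ∷ F₁)  F₂ (true ∷ X₁) X₂ = begin
  ⁅ zero ⁆ ∪ image (λ j → suc (enum-++ F₁ F₂ j)) (X₁ ++ X₂)
    ≡⟨ cong (⁅ zero ⁆ ∪_) (image-suc (enum-++ F₁ F₂) (X₁ ++ X₂)) ⟩
  true ∷ (∅ ∪ image (enum-++ F₁ F₂) (X₁ ++ X₂))
    ≡⟨ cong (true ∷_) (trans (∪-identityˡ _) (image-enum-++ F₁ F₂ X₁ X₂)) ⟩
  true ∷ (image (enum F₁) X₁ ++ image (enum F₂) X₂)
    ≡⟨ cong (λ Z → (true ∷ Z) ++ image (enum F₂) X₂) (sym (∪-identityˡ _)) ⟩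
  (⁅ zero ⁆ ∪ (false ∷ image (enum F₁) X₁)) ++ image (enum F₂) X₂
    ≡⟨ cong (λ Z → (⁅ zero ⁆ ∪ Z) ++ image (enum F₂) X₂) (sym (image-suc (enum F₁) X₁)) ⟩
  image (enum (true ∷ F₁)) (true ∷ X₁) ++ image (enum F₂) X₂ ∎
  where open ≡-Reasoning
image-enum-++ (true ∷ F₁)  F₂ (false ∷ X₁) X₂ =
  trans (image-suc (enum-++ F₁ F₂) (X₁ ++ X₂))
        (trans (cong (false ∷_) (image-enum-++ F₁ F₂ X₁ X₂))
               (cong (_++ image (enum F₂) X₂) (sym (image-suc (enum F₁) X₁))))
image-enum-++ (false ∷ F₁) F₂ X₁           X₂ =
  trans (image-suc (enum-++ F₁ F₂) (X₁ ++ X₂))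
        (trans (cong (false ∷_) (image-enum-++ F₁ F₂ X₁ X₂))
               (cong (_++ image (enum F₂) X₂) (sym (image-suc (enum F₁) X₁))))

image-enum-full : ∀ {n} (F : Subset n) → image (enum F) full ≡ F
image-enum-full F = image-unique (enum F) full F (λ i p → let (j , e) = ∈⇒∈-enum F p in j , ∈⊤ , e)
                                                 (λ j _ → enum-∈ F j)

image-enum-++-full : ∀ {a b} (F₁ : Subset a) (F₂ : Subset b) → image (enum-++ F₁ F₂) full ≡ F₁ ++ F₂
image-enum-++-full F₁ F₂ = begin
  image (enum-++ F₁ F₂) full                            ≡⟨ cong (image (enum-++ F₁ F₂)) (full-++ ∣ F₁ ∣ ∣ F₂ ∣) ⟩
  image (enum-++ F₁ F₂) (full {∣ F₁ ∣} ++ full)         ≡⟨ image-enum-++ F₁ F₂ full full ⟩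
  image (enum F₁) full ++ image (enum F₂) full          ≡⟨ cong₂ _++_ (image-enum-full F₁) (image-enum-full F₂) ⟩
  F₁ ++ F₂                                              ∎
  where open ≡-Reasoning

module DirectSum {a b} {M₁ : Matroid a} {M₂ : Matroid b} (N : Matroid (a + b))
  (N-ind : ∀ X → Ind N X ⇔ (Ind M₁ (take a X) × Ind M₂ (drop a X))) where

  Ind-++ : ∀ A B → Ind N (A ++ B) ⇔ (Ind M₁ A × Ind M₂ B)
  Ind-++ A B = mk⇔
    (λ ind → let (ind₁ , ind₂) = to (N-ind (A ++ B)) ind
             in subst (Ind M₁) (take-++ A B) ind₁ , subst (Ind M₂) (drop-++ A B) ind₂)
    (λ { (ind₁ , ind₂) → from (N-ind (A ++ B)) (subst (Ind M₁) (sym (take-++ A B)) ind₁ ,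
                                                 subst (Ind M₂) (sym (drop-++ A B)) ind₂) })

  RankIs-++ : ∀ {A B r s} → RankIs M₁ A r → RankIs M₂ B s → RankIs N (A ++ B) (r + s)
  RankIs-++ {A} {B} {r} {s} ((I₁ , I₁⊆A , ind₁ , ∣I₁∣≡r) , bound₁) ((I₂ , I₂⊆B , ind₂ , ∣I₂∣≡s) , bound₂) =
    (I₁ ++ I₂ , ++-⊆ {A = I₁} {A} I₁⊆A I₂⊆B , from (Ind-++ I₁ I₂) (ind₁ , ind₂) ,
     trans (∣++∣ I₁ I₂) (cong₂ _+_ ∣I₁∣≡r ∣I₂∣≡s)) , bound
    where
    bound : ∀ J → J ⊆ A ++ B → Ind N J → ∣ J ∣ ≤ r + s
    bound J J⊆AB indJ =
      let J₁ = take a J ; J₂ = drop a J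
          J₁₂≡J = take++drop≡id a J
          (J₁⊆A , J₂⊆B) = ++-⊆⁻ {A = J₁} {A} (λ {z} p → J⊆AB (subst (z ∈_) J₁₂≡J p))
          (indJ₁ , indJ₂) = to (Ind-++ J₁ J₂) (subst (Ind N) (sym J₁₂≡J) indJ)
      in subst (_≤ r + s) (trans (sym (∣++∣ J₁ J₂)) (cong ∣_∣ J₁₂≡J))
               (+-mono-≤ (bound₁ J₁ J₁⊆A indJ₁) (bound₂ J₂ J₂⊆B indJ₂))

  -- Flatness is a negative statement, so the missing rank of the other summand may be
  -- obtained classically.
  IsFlat-++ˡ : ∀ {F₁ F₂} → IsFlat N (F₁ ++ F₂) → IsFlat M₁ F₁
  IsFlat-++ˡ {F₁} {F₂} flat x x∉F₁ r rank rank' = ¬¬-rank M₂ F₂ λ { (s , rank₂) →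
    flat (x ↑ˡ b) (λ p → x∉F₁ (↑ˡ∈-++⁻ F₁ F₂ x p)) (r + s) (RankIs-++ rank rank₂)
         (subst (λ Z → RankIs N Z (r + s)) (sym (⁅↑ˡ⁆∪-++ x F₁ F₂)) (RankIs-++ rank' rank₂)) }

  IsFlat-++ʳ : ∀ {F₁ F₂} → IsFlat N (F₁ ++ F₂) → IsFlat M₂ F₂
  IsFlat-++ʳ {F₁} {F₂} flat y y∉F₂ s rank rank' = ¬¬-rank M₁ F₁ λ { (r , rank₁) →
    flat (a ↑ʳ y) (λ p → y∉F₂ (↑ʳ∈-++⁻ F₁ F₂ y p)) (r + s) (RankIs-++ rank₁ rank)
         (subst (λ Z → RankIs N Z (r + s)) (sym (⁅↑ʳ⁆∪-++ y F₁ F₂)) (RankIs-++ rank₁ rank')) }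

  module _ (F₁ : Subset a) (F₂ : Subset b) where

    restriction-sum : Matroid (∣ F₁ ∣ + ∣ F₂ ∣)
    restriction-sum = pullback N (enum-++ F₁ F₂) (enum-++-injective F₁ F₂)

    restriction-sum-ind : ∀ X → Ind restriction-sum X ⇔
      (Ind (restriction M₁ F₁) (take ∣ F₁ ∣ X) × Ind (restriction M₂ F₂) (drop ∣ F₁ ∣ X))
    restriction-sum-ind X = mk⇔ (λ ind → to (Ind-++ X₁ X₂) (subst (Ind N) image≡ ind))
                                (λ ind → subst (Ind N) (sym image≡) (from (Ind-++ X₁ X₂) ind))
      where
      X₁ : Subset a
      X₁ = image (enum F₁) (take ∣ F₁ ∣ X)
      X₂ : Subset b
      X₂ = image (enum F₂) (drop ∣ F₁ ∣ X)
      image≡ : image (enum-++ F₁ F₂) X ≡ X₁ ++ X₂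
      image≡ = trans (cong (image (enum-++ F₁ F₂)) (sym (take++drop≡id ∣ F₁ ∣ X)))
                     (image-enum-++ F₁ F₂ (take ∣ F₁ ∣ X) (drop ∣ F₁ ∣ X))

    restriction-++-≅ : restriction N (F₁ ++ F₂) ≅ restriction-sum
    restriction-++-≅ = pullback-≅ {N = N} {M = N} (≅-refl N) (enum (F₁ ++ F₂)) (enum-injective (F₁ ++ F₂))
                                  (enum-++ F₁ F₂) (enum-++-injective F₁ F₂) h g∘h≡f h-surj
      where
      ∈-range : ∀ {i} → i ∈ F₁ ++ F₂ → ∃ λ j → enum-++ F₁ F₂ j ≡ i
      ∈-range {i} p with ∈-image⁻ (enum-++ F₁ F₂) full (subst (i ∈_) (sym (image-enum-++-full F₁ F₂)) p)
      ... | j , _ , e = j , e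
      h : Fin ∣ F₁ ++ F₂ ∣ → Fin (∣ F₁ ∣ + ∣ F₂ ∣)
      h j = proj₁ (∈-range (enum-∈ (F₁ ++ F₂) j))
      g∘h≡f : ∀ j → enum-++ F₁ F₂ (h j) ≡ enum (F₁ ++ F₂) j
      g∘h≡f j = proj₂ (∈-range (enum-∈ (F₁ ++ F₂) j))
      h-surj : ∀ j₂ → ∃ λ j₁ → h j₁ ≡ j₂
      h-surj j₂ with ∈⇒∈-enum (F₁ ++ F₂) (subst (enum-++ F₁ F₂ j₂ ∈_) (image-enum-++-full F₁ F₂)
                                                (∈-image⁺ (enum-++ F₁ F₂) full (∈⊤ {x = j₂})))
      ... | j₁ , e = j₁ , enum-++-injective F₁ F₂ (trans (g∘h≡f j₁) e)

    restriction-++-IsComatroid : ∀ {q} → IsComatroid q (restriction M₁ F₁) → IsComatroid q (restriction M₂ F₂) →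
                                 IsComatroid q (restriction N (F₁ ++ F₂))
    restriction-++-IsComatroid M₁|F₁ M₂|F₂ =
      iso (dsum M₁|F₁ M₂|F₂ restriction-sum restriction-sum-ind) restriction-++-≅

-- Finite sums

∑-cong : ∀ {n} {f g : Fin n → ℕ} → (∀ i → f i ≡ g i) → ∑ f ≡ ∑ g
∑-cong {zero}  f≗g = refl
∑-cong {suc n} f≗g = cong₂ _+_ (f≗g zero) (∑-cong (λ i → f≗g (suc i)))

∑-zero : ∀ {n} {f : Fin n → ℕ} → (∀ i → f i ≡ 0) → ∑ f ≡ 0
∑-zero {zero}  f≗0 = refl
∑-zero {suc n} f≗0 = cong₂ _+_ (f≗0 zero) (∑-zero (λ i → f≗0 (suc i)))

∑-distrib-+ : ∀ {n} (f g : Fin n → ℕ) → ∑ (λ i → f i + g i) ≡ ∑ f + ∑ g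
∑-distrib-+ {zero}  f g = refl
∑-distrib-+ {suc n} f g =
  trans (cong (f zero + g zero +_) (∑-distrib-+ (λ i → f (suc i)) (λ i → g (suc i)))) (interchange (f zero) (g zero) _ _)
  where
  interchange : ∀ a b c d → a + b + (c + d) ≡ a + c + (b + d)
  interchange = solve-∀

∑-*ˡ : ∀ {n} (c : ℕ) (f : Fin n → ℕ) → ∑ (λ i → c * f i) ≡ c * ∑ f
∑-*ˡ {zero}  c f = sym (*-zeroʳ c)
∑-*ˡ {suc n} c f = trans (cong (c * f zero +_) (∑-*ˡ c (λ i → f (suc i)))) (sym (*-distribˡ-+ c (f zero) _))

∑-*ʳ : ∀ {n} (c : ℕ) (f : Fin n → ℕ) → ∑ (λ i → f i * c) ≡ ∑ f * c
∑-*ʳ c f = trans (∑-cong (λ i → *-comm (f i) c)) (trans (∑-*ˡ c f) (*-comm c (∑ f)))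

∑-comm : ∀ {m n} (f : Fin m → Fin n → ℕ) → ∑ (λ i → ∑ (λ l → f i l)) ≡ ∑ (λ l → ∑ (λ i → f i l))
∑-comm {zero}  f = sym (∑-zero {f = λ l → ∑ (λ i → f i l)} (λ l → refl))
∑-comm {suc m} f = trans (cong (∑ (f zero) +_) (∑-comm (λ i → f (suc i))))
                         (sym (∑-distrib-+ (f zero) (λ l → ∑ (λ i → f (suc i) l))))

∑-assoc-matrix : ∀ {m k} (c : Fin m → ℕ) (A : Fin m → Fin k → ℕ) (w : Fin k → ℕ) →
  ∑ (λ i → c i * ∑ (λ l → A i l * w l)) ≡ ∑ (λ l → ∑ (λ i → c i * A i l) * w l)
∑-assoc-matrix c A w = begin
  ∑ (λ i → c i * ∑ (λ l → A i l * w l))   ≡⟨ ∑-cong (λ i → sym (∑-*ˡ (c i) (λ l → A i l * w l))) ⟩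
  ∑ (λ i → ∑ (λ l → c i * (A i l * w l))) ≡⟨ ∑-comm (λ i l → c i * (A i l * w l)) ⟩
  ∑ (λ l → ∑ (λ i → c i * (A i l * w l))) ≡⟨ ∑-cong (λ l → ∑-cong (λ i → sym (*-assoc (c i) (A i l) (w l)))) ⟩
  ∑ (λ l → ∑ (λ i → c i * A i l * w l))   ≡⟨ ∑-cong (λ l → ∑-*ʳ (w l) (λ i → c i * A i l)) ⟩
  ∑ (λ l → ∑ (λ i → c i * A i l) * w l)   ∎
  where open ≡-Reasoning

δ : ∀ {n} → Fin n → Fin n → ℕ
δ zero    zero    = 1
δ zero    (suc l) = 0
δ (suc i) zero    = 0
δ (suc i) (suc l) = δ i l

δ-diag : ∀ {n} (i : Fin n) → δ i i ≡ 1
δ-diag zero    = refl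
δ-diag (suc i) = δ-diag i

δ-off : ∀ {n} (i l : Fin n) → l ≢ i → δ i l ≡ 0
δ-off zero    zero    l≢i = ⊥-elim (l≢i refl)
δ-off zero    (suc l) l≢i = refl
δ-off (suc i) zero    l≢i = refl
δ-off (suc i) (suc l) l≢i = δ-off i l (λ e → l≢i (cong suc e))

∑-δ : ∀ {n} (i : Fin n) (f : Fin n → ℕ) → ∑ (λ l → δ i l * f l) ≡ f i
∑-δ zero    f = trans (cong (f zero + 0 +_) (∑-zero {f = λ l → δ zero (suc l) * f (suc l)} (λ l → refl)))
                    (trans (+-identityʳ _) (+-identityʳ _))
∑-δ (suc i) f = ∑-δ i (λ l → f (suc l))

∑-enum : ∀ {n} (F : Subset n) (g : Fin n → ℕ) → (∀ i → i ∉ F → g i ≡ 0) → ∑ g ≡ ∑ (λ l → g (enum F l))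
∑-enum []          g g≡0 = refl
∑-enum (true ∷ F)  g g≡0 =
  cong (g zero +_) (∑-enum F (λ i → g (suc i)) (λ i i∉F → g≡0 (suc i) (λ { (there p) → i∉F p })))
∑-enum (false ∷ F) g g≡0 =
  trans (cong (_+ ∑ (λ i → g (suc i))) (g≡0 zero (λ ())))
        (∑-enum F (λ i → g (suc i)) (λ i i∉F → g≡0 (suc i) (λ { (there p) → i∉F p })))

extend : ∀ {n} {A : Set} (F : Subset n) → (Fin ∣ F ∣ → A) → A → Fin n → A
extend (true ∷ F)  a d zero    = a zero
extend (true ∷ F)  a d (suc i) = extend F (λ l → a (suc l)) d i
extend (false ∷ F) a d zero    = d
extend (false ∷ F) a d (suc i) = extend F a d i

extend-enum : ∀ {n} {A : Set} (F : Subset n) (a : Fin ∣ F ∣ → A) d l → extend F a d (enum F l) ≡ a l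
extend-enum (true ∷ F)  a d zero    = refl
extend-enum (true ∷ F)  a d (suc l) = extend-enum F (λ l → a (suc l)) d l
extend-enum (false ∷ F) a d l       = extend-enum F a d l

extend-∉ : ∀ {n} {A : Set} (F : Subset n) (a : Fin ∣ F ∣ → A) d i → i ∉ F → extend F a d i ≡ d
extend-∉ (true ∷ F)  a d zero    i∉F = ⊥-elim (i∉F here)
extend-∉ (true ∷ F)  a d (suc i) i∉F = extend-∉ F (λ l → a (suc l)) d i (λ p → i∉F (there p))
extend-∉ (false ∷ F) a d zero    i∉F = refl
extend-∉ (false ∷ F) a d (suc i) i∉F = extend-∉ F a d i (λ p → i∉F (there p))

∃-function? : ∀ {r} k {P : (Fin k → Fin r) → Set} → (∀ {f g} → (∀ i → f i ≡ g i) → P f → P g) →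
              (∀ f → Dec (P f)) → Dec (∃ P)
∃-function? zero {P} resp P? with P? (λ ())
... | yes p = yes (_ , p)
... | no ¬p = no (λ { (f , pf) → ¬p (resp (λ ()) pf) })
∃-function? {r} (suc k) {P} resp P?
  with any? (λ x → ∃-function? k {λ f → P (cons x f)} (λ f≗g → resp (cons-cong f≗g)) (λ f → P? (cons x f)))
  where
  cons : Fin r → (Fin k → Fin r) → Fin (suc k) → Fin r
  cons x f zero    = x
  cons x f (suc i) = f i
  cons-cong : ∀ {x f g} → (∀ i → f i ≡ g i) → ∀ i → cons x f i ≡ cons x g i
  cons-cong f≗g zero    = refl
  cons-cong f≗g (suc i) = f≗g i
... | yes (x , f , p) = yes (_ , p)
... | no ¬p = no (λ { (f , pf) → ¬p (f zero , (λ i → f (suc i)) , resp (λ { zero → refl ; (suc i) → refl }) pf) })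

-- Arithmetic modulo q

module Modular (q : ℕ) {{_ : NonZero q}} (1<q : 1 < q) where

  infix 4 _≈_
  _≈_ : ℕ → ℕ → Set
  a ≈ b = a % q ≡ b % q

  ≈-setoid : Setoid _ _
  ≈-setoid = record
    { Carrier       = ℕ
    ; _≈_           = _≈_
    ; isEquivalence = record { refl = refl ; sym = sym ; trans = trans }
    }

  open Setoid ≈-setoid public using () renaming (refl to ≈-refl; sym to ≈-sym; trans to ≈-trans)
  module ≈-Reasoning = SetoidReasoning ≈-setoid

  ≡⇒≈ : ∀ {a b} → a ≡ b → a ≈ b
  ≡⇒≈ = cong (_% q)

  +-cong : ∀ {a a' b b'} → a ≈ a' → b ≈ b' → a + b ≈ a' + b'
  +-cong {a} {a'} {b} {b'} a≈a' b≈b' =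
    trans (%-distribˡ-+ a b q) (trans (cong₂ (λ x y → (x + y) % q) a≈a' b≈b') (sym (%-distribˡ-+ a' b' q)))

  *-cong : ∀ {a a' b b'} → a ≈ a' → b ≈ b' → a * b ≈ a' * b'
  *-cong {a} {a'} {b} {b'} a≈a' b≈b' =
    trans (%-distribˡ-* a b q) (trans (cong₂ (λ x y → (x * y) % q) a≈a' b≈b') (sym (%-distribˡ-* a' b' q)))

  *-congˡ : ∀ c {b b'} → b ≈ b' → c * b ≈ c * b'
  *-congˡ c = *-cong (≈-refl {c})

  0%q : 0 % q ≡ 0
  0%q = m<n⇒m%n≡m (<-≤-trans (s≤s z≤n) 1<q)

  1%q : 1 % q ≡ 1
  1%q = m<n⇒m%n≡m 1<q

  *q≈0 : ∀ x → x * q ≈ 0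
  *q≈0 x = trans (m*n%n≡0 x q) (sym 0%q)

  ∣⇒≈0 : ∀ {x} → q ∣ x → x ≈ 0
  ∣⇒≈0 {x} q∣x = trans (n∣m⇒m%n≡0 x q q∣x) (sym 0%q)

  ≈0⇒∣ : ∀ {x} → x ≈ 0 → q ∣ x
  ≈0⇒∣ {x} x≈0 = m%n≡0⇒n∣m x q (trans x≈0 0%q)

  toℕ≈0⇒≡0 : ∀ (c : Fin q) → toℕ c ≈ 0 → toℕ c ≡ 0
  toℕ≈0⇒≡0 c c≈0 = trans (sym (m<n⇒m%n≡m (toℕ<n c))) (trans c≈0 0%q)

  reduce : ℕ → Fin q
  reduce x = fromℕ< (m%n<n x q)

  reduce-≈ : ∀ x → toℕ (reduce x) ≈ x
  reduce-≈ x = trans (cong (_% q) (toℕ-fromℕ< (m%n<n x q))) (m%n%n≡m%n x q)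

  ≈0⇒reduce≡0 : ∀ x → x ≈ 0 → toℕ (reduce x) ≡ 0
  ≈0⇒reduce≡0 x x≈0 = trans (toℕ-fromℕ< (m%n<n x q)) (trans x≈0 0%q)

  reduce-0 : toℕ (reduce 0) ≡ 0
  reduce-0 = ≈0⇒reduce≡0 0 refl

  ∑-cong-≈ : ∀ {n} {f g : Fin n → ℕ} → (∀ i → f i ≈ g i) → ∑ f ≈ ∑ g
  ∑-cong-≈ {zero}  f≈g = refl
  ∑-cong-≈ {suc n} f≈g = +-cong (f≈g zero) (∑-cong-≈ (λ i → f≈g (suc i)))

  -- q-1 plays the role of the scalar -1, as in the definition of Parallel.
  q-1 : ℕ
  q-1 = q ∸ 1

  q-1+1≡q : q-1 + 1 ≡ q
  q-1+1≡q = m∸n+n≡m (<-≤-trans (s≤s z≤n) 1<q)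

  [q-1]y+y≈0 : ∀ y → q-1 * y + y ≈ 0
  [q-1]y+y≈0 y = ≈-trans (≡⇒≈ (trans (factor y q-1) (cong (y *_) q-1+1≡q))) (*q≈0 y)
    where
    factor : ∀ y r → r * y + y ≡ y * (r + 1)
    factor = solve-∀

  q-1≉0 : ¬ (q-1 ≈ 0)
  q-1≉0 q-1≈0 = <-irrefl (subst (λ z → z + 1 ≡ q) q-1≡0 q-1+1≡q) 1<q
    where
    q-1<q : q-1 < q
    q-1<q = subst (q-1 <_) q-1+1≡q (subst (_≤ q-1 + 1) (+-comm q-1 1) ≤-refl)
    q-1≡0 : q-1 ≡ 0
    q-1≡0 = trans (sym (m<n⇒m%n≡m q-1<q)) (trans q-1≈0 0%q)

  x+[q-1]y≈0⇒x≈y : ∀ x y → x + q-1 * y ≈ 0 → x ≈ y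
  x+[q-1]y≈0⇒x≈y x y x-y≈0 = begin
    x                     ≡⟨ sym (+-identityʳ x) ⟩
    x + 0                 ≈⟨ +-cong (≈-refl {x}) (≈-sym ([q-1]y+y≈0 y)) ⟩
    x + (q-1 * y + y)     ≡⟨ sym (+-assoc x (q-1 * y) y) ⟩
    x + q-1 * y + y       ≈⟨ +-cong x-y≈0 (≈-refl {y}) ⟩
    y                     ∎
    where open ≈-Reasoning

-- For q ∈ {2, 3} every nonzero residue is its own inverse; this is the only property of
-- q beyond 1 < q that the argument needs.
module SelfInverse (q : ℕ) {{_ : NonZero q}} (1<q : 1 < q)
  (c*c≡1 : ∀ (c : Fin q) → toℕ c ≢ 0 → (toℕ c * toℕ c) % q ≡ 1) where
  open Modular q 1<q

  c*c≈1 : ∀ (c : Fin q) → toℕ c ≢ 0 → toℕ c * toℕ c ≈ 1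
  c*c≈1 c c≢0 = trans (c*c≡1 c c≢0) (sym 1%q)

  c*x+[q-1]y≈0⇒x≈c*y : ∀ (c : Fin q) → toℕ c ≢ 0 → ∀ x y → toℕ c * x + q-1 * y ≈ 0 → x ≈ toℕ c * y
  c*x+[q-1]y≈0⇒x≈c*y c c≢0 x y cx-y≈0 = x+[q-1]y≈0⇒x≈y x (a * y) (begin
    x + q-1 * (a * y)             ≡⟨ cong (_+ q-1 * (a * y)) (sym (*-identityˡ x)) ⟩
    1 * x + q-1 * (a * y)         ≈⟨ +-cong (*-cong (≈-sym (c*c≈1 c c≢0)) (≈-refl {x})) (≈-refl {q-1 * (a * y)}) ⟩
    a * a * x + q-1 * (a * y)     ≡⟨ expand a x y q-1 ⟩
    a * (a * x + q-1 * y)         ≈⟨ *-congˡ a cx-y≈0 ⟩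
    a * 0                         ≡⟨ *-zeroʳ a ⟩
    0                             ∎)
    where
    a : ℕ
    a = toℕ c
    open ≈-Reasoning
    expand : ∀ a x y r → a * a * x + r * (a * y) ≡ a * (a * x + r * y)
    expand = solve-∀

-- Linear algebra over GF(q), with vectors given by natural-number entries read modulo q

module LinearAlgebra (q : ℕ) {{_ : NonZero q}} (1<q : 1 < q)
  (c*c≡1 : ∀ (c : Fin q) → toℕ c ≢ 0 → (toℕ c * toℕ c) % q ≡ 1) where
  open Modular q 1<q public
  open SelfInverse q 1<q c*c≡1 public

  combination : ∀ {n t} → (Fin n → ℕ) → (Fin n → Fin t → ℕ) → Fin t → ℕ
  combination c W j = ∑ (λ i → c i * W i j)

  SupportedOn : ∀ {n} → (Fin n → Fin q) → Subset n → Set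
  SupportedOn c B = ∀ i → toℕ (c i) ≢ 0 → i ∈ B

  DependentIn : ∀ {n t} → (Fin n → Fin t → ℕ) → Subset n → Set
  DependentIn {n} {t} W X = ∃ λ (c : Fin n → Fin q) →
    SupportedOn c X × (∃ λ i → toℕ (c i) ≢ 0) × (∀ (j : Fin t) → q ∣ combination (λ i → toℕ (c i)) W j)

  InSpan : ∀ {n t} → (Fin n → Fin t → ℕ) → Subset n → (Fin t → ℕ) → Set
  InSpan {n} W B v = ∃ λ (c : Fin n → Fin q) → SupportedOn c B × (∀ j → v j ≈ combination (λ i → toℕ (c i)) W j)

  toℕ≟0 : ∀ (c : Fin q) → Dec (toℕ c ≡ 0)
  toℕ≟0 c = toℕ c ≟ℕ 0

  outside-support : ∀ {n} {c : Fin n → Fin q} {B} → SupportedOn c B → ∀ {i} → i ∉ B → toℕ (c i) ≡ 0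
  outside-support {c = c} supp {i} i∉B with toℕ≟0 (c i)
  ... | yes ci≡0 = ci≡0
  ... | no  ci≢0 = ⊥-elim (i∉B (supp i ci≢0))

  combination-+δ : ∀ {n} (x y : ℕ) (c : Fin n → ℕ) (i : Fin n) (w : Fin n → ℕ) →
    ∑ (λ l → (x * c l + y * δ i l) * w l) ≡ x * ∑ (λ l → c l * w l) + y * w i
  combination-+δ x y c i w = begin
    ∑ (λ l → (x * c l + y * δ i l) * w l)                 ≡⟨ ∑-cong (λ l → distrib x y (c l) (δ i l) (w l)) ⟩
    ∑ (λ l → x * (c l * w l) + y * (δ i l * w l))         ≡⟨ ∑-distrib-+ (λ l → x * (c l * w l)) (λ l → y * (δ i l * w l)) ⟩
    ∑ (λ l → x * (c l * w l)) + ∑ (λ l → y * (δ i l * w l))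
      ≡⟨ cong₂ _+_ (∑-*ˡ x (λ l → c l * w l)) (trans (∑-*ˡ y (λ l → δ i l * w l)) (cong (y *_) (∑-δ i w))) ⟩
    x * ∑ (λ l → c l * w l) + y * w i                     ∎
    where
    open ≡-Reasoning
    distrib : ∀ x y c d w → (x * c + y * d) * w ≡ x * (c * w) + y * (d * w)
    distrib = solve-∀

  module Span {n t} (W : Fin n → Fin t → ℕ) where

    ∈⇒InSpan : ∀ {B i} → i ∈ B → InSpan W B (W i)
    ∈⇒InSpan {B} {i} i∈B = (λ l → reduce (δ i l)) , supp , W-i≈
      where
      supp : SupportedOn (λ l → reduce (δ i l)) B
      supp l cl≢0 with l ≟F i
      ... | yes refl = i∈B
      ... | no  l≢i  = ⊥-elim (cl≢0 (subst (λ z → toℕ (reduce z) ≡ 0) (sym (δ-off i l l≢i)) reduce-0))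
      W-i≈ : ∀ j → W i j ≈ combination (λ l → toℕ (reduce (δ i l))) W j
      W-i≈ j = ≈-sym (≈-trans (∑-cong-≈ (λ l → *-cong (reduce-≈ (δ i l)) (≈-refl {W l j})))
                              (≡⇒≈ (∑-δ i (λ l → W l j))))

    -- The coefficients c - e_i witness the dependence.
    InSpan⇒dependent : ∀ {B i} → i ∉ B → InSpan W B (W i) → DependentIn W (⁅ i ⁆ ∪ B)
    InSpan⇒dependent {B} {i} i∉B (c , supp , W-i≈) = c' , supp' , (i , c'i≢0) , sums
      where
      c'ℕ : Fin n → ℕ
      c'ℕ l = 1 * toℕ (c l) + q-1 * δ i l
      c' : Fin n → Fin q
      c' l = reduce (c'ℕ l)
      supp' : SupportedOn c' (⁅ i ⁆ ∪ B)
      supp' l c'l≢0 with l ≟F i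
      ... | yes l≡i = p⊆p∪q B (x≡y⇒x∈⁅y⁆ l≡i)
      ... | no  l≢i with toℕ≟0 (c l)
      ... | no  cl≢0 = q⊆p∪q ⁅ i ⁆ B (supp l cl≢0)
      ... | yes cl≡0 = ⊥-elim (c'l≢0 (≈0⇒reduce≡0 (c'ℕ l) (≡⇒≈
              (cong₂ _+_ (trans (+-identityʳ _) cl≡0) (trans (cong (q-1 *_) (δ-off i l l≢i)) (*-zeroʳ q-1))))))
      c'i≢0 : toℕ (c' i) ≢ 0
      c'i≢0 c'i≡0 = q-1≉0 (≈-trans (≡⇒≈ q-1≡c'ℕi) (≈-trans (≈-sym (reduce-≈ (c'ℕ i))) (≡⇒≈ c'i≡0)))
        where
        q-1≡c'ℕi : q-1 ≡ c'ℕ i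
        q-1≡c'ℕi = sym (cong₂ _+_ (trans (+-identityʳ _) (outside-support supp i∉B))
                                  (trans (cong (q-1 *_) (δ-diag i)) (*-identityʳ q-1)))
      sums : ∀ j → q ∣ combination (λ l → toℕ (c' l)) W j
      sums j = ≈0⇒∣ (begin
        combination (λ l → toℕ (c' l)) W j        ≈⟨ ∑-cong-≈ (λ l → *-cong (reduce-≈ (c'ℕ l)) (≈-refl {W l j})) ⟩
        ∑ (λ l → c'ℕ l * W l j)                   ≡⟨ combination-+δ 1 q-1 (λ l → toℕ (c l)) i (λ l → W l j) ⟩
        1 * combination (λ l → toℕ (c l)) W j + q-1 * W i j
                                                  ≈⟨ +-cong (≈-trans (≡⇒≈ (*-identityˡ _)) (≈-sym (W-i≈ j)))
                                                            (≈-refl {q-1 * W i j}) ⟩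
        W i j + q-1 * W i j                       ≡⟨ +-comm (W i j) (q-1 * W i j) ⟩
        q-1 * W i j + W i j                       ≈⟨ [q-1]y+y≈0 (W i j) ⟩
        0                                         ∎)
        where open ≈-Reasoning

    dependent-pivot : ∀ {B i} → ¬ DependentIn W B → (c : Fin n → Fin q) → SupportedOn c (⁅ i ⁆ ∪ B) →
      (∃ λ l → toℕ (c l) ≢ 0) → (∀ j → q ∣ combination (λ l → toℕ (c l)) W j) → toℕ (c i) ≢ 0
    dependent-pivot {B} {i} B-indep c supp nonzero sums ci≡0 = B-indep (c , suppB , nonzero , sums)
      where
      suppB : SupportedOn c B
      suppB l cl≢0 with x∈p∪q⁻ ⁅ i ⁆ B (supp l cl≢0)
      ... | inj₁ l∈⁅i⁆ = ⊥-elim (cl≢0 (subst (λ z → toℕ (c z) ≡ 0) (sym (x∈⁅y⁆⇒x≡y i l∈⁅i⁆)) ci≡0))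
      ... | inj₂ l∈B   = l∈B

    -- Solving the dependence for W i: its coefficient a is nonzero, and -a⁻¹ = (q-1) a.
    dependent⇒InSpan : ∀ {B i} → ¬ DependentIn W B → DependentIn W (⁅ i ⁆ ∪ B) → InSpan W B (W i)
    dependent⇒InSpan {B} {i} B-indep (c , supp , nonzero , sums) = d , suppB , W-i≈
      where
      ci≢0 : toℕ (c i) ≢ 0
      ci≢0 = dependent-pivot B-indep c supp nonzero sums
      a : ℕ
      a = toℕ (c i)
      dℕ : Fin n → ℕ
      dℕ l = (a * q-1) * toℕ (c l) + 1 * δ i l
      d : Fin n → Fin q
      d l = reduce (dℕ l)
      di≡0 : toℕ (d i) ≡ 0
      di≡0 = ≈0⇒reduce≡0 (dℕ i) (begin
        a * q-1 * a + 1 * δ i i    ≡⟨ cong (a * q-1 * a +_) (trans (*-identityˡ _) (δ-diag i)) ⟩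
        a * q-1 * a + 1            ≡⟨ rearrange a q-1 ⟩
        q-1 * (a * a) + 1          ≈⟨ +-cong (*-congˡ q-1 (c*c≈1 (c i) ci≢0)) (≈-refl {1}) ⟩
        q-1 * 1 + 1                ≈⟨ [q-1]y+y≈0 1 ⟩
        0                          ∎)
        where
        open ≈-Reasoning
        rearrange : ∀ a r → a * r * a + 1 ≡ r * (a * a) + 1
        rearrange = solve-∀
      suppB : SupportedOn d B
      suppB l dl≢0 with l ≟F i
      ... | yes refl = ⊥-elim (dl≢0 di≡0)
      ... | no  l≢i with toℕ≟0 (c l)
      ... | yes cl≡0 = ⊥-elim (dl≢0 (≈0⇒reduce≡0 (dℕ l) (≡⇒≈
              (cong₂ _+_ (trans (cong (a * q-1 *_) cl≡0) (*-zeroʳ (a * q-1))) (trans (*-identityˡ _) (δ-off i l l≢i))))))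
      ... | no  cl≢0 with x∈p∪q⁻ ⁅ i ⁆ B (supp l cl≢0)
      ... | inj₁ l∈⁅i⁆ = ⊥-elim (l≢i (x∈⁅y⁆⇒x≡y i l∈⁅i⁆))
      ... | inj₂ l∈B   = l∈B
      W-i≈ : ∀ j → W i j ≈ combination (λ l → toℕ (d l)) W j
      W-i≈ j = ≈-sym (begin
        combination (λ l → toℕ (d l)) W j       ≈⟨ ∑-cong-≈ (λ l → *-cong (reduce-≈ (dℕ l)) (≈-refl {W l j})) ⟩
        ∑ (λ l → dℕ l * W l j)                  ≡⟨ combination-+δ (a * q-1) 1 (λ l → toℕ (c l)) i (λ l → W l j) ⟩
        a * q-1 * combination (λ l → toℕ (c l)) W j + 1 * W i j
                                                ≈⟨ +-cong (*-congˡ (a * q-1) (∣⇒≈0 (sums j))) (≈-refl {1 * W i j}) ⟩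
        a * q-1 * 0 + 1 * W i j                 ≡⟨ cong₂ _+_ (*-zeroʳ (a * q-1)) (*-identityˡ (W i j)) ⟩
        W i j                                   ∎)
        where open ≈-Reasoning

    InSpan? : ∀ B v → Dec (InSpan W B v)
    InSpan? B v = ∃-function? n resp P?
      where
      P : (Fin n → Fin q) → Set
      P c = SupportedOn c B × (∀ j → v j ≈ combination (λ i → toℕ (c i)) W j)
      resp : ∀ {f g} → (∀ i → f i ≡ g i) → P f → P g
      resp f≗g (supp , v≈) =
        (λ i gi≢0 → supp i (λ fi≡0 → gi≢0 (trans (cong toℕ (sym (f≗g i))) fi≡0))) ,
        (λ j → trans (v≈ j) (cong (_% q) (∑-cong (λ i → cong (λ z → toℕ z * W i j) (f≗g i)))))
      P? : ∀ c → Dec (P c)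
      P? c = all? (λ i → ¬? (toℕ≟0 (c i)) →-dec (i ∈? B))
             ×-dec all? (λ j → (v j % q) ≟ℕ (combination (λ i → toℕ (c i)) W j % q))

  InSpan-trans : ∀ {n n' t} (W : Fin n → Fin t → ℕ) (W' : Fin n' → Fin t → ℕ) {B I v} →
    InSpan W' I v → (∀ i → i ∈ I → InSpan W B (W' i)) → InSpan W B v
  InSpan-trans {n} {n'} {t} W W' {B} {I} {v} (c , supp , v≈) W'-I⊆span = e , suppB , v≈'
    where
    -- junk coefficients 0 for i ∉ I
    d : Fin n' → Fin n → Fin q
    d i with i ∈? I
    ... | yes i∈I = proj₁ (W'-I⊆span i i∈I)
    ... | no  _   = λ _ → reduce 0
    d-supp : ∀ i → SupportedOn (d i) B
    d-supp i with i ∈? I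
    ... | yes i∈I = proj₁ (proj₂ (W'-I⊆span i i∈I))
    ... | no  _   = λ l 0≢0 → ⊥-elim (0≢0 reduce-0)
    W'≈ : ∀ i → i ∈ I → ∀ j → W' i j ≈ combination (λ l → toℕ (d i l)) W j
    W'≈ i i∈I with i ∈? I
    ... | yes i∈I' = proj₂ (proj₂ (W'-I⊆span i i∈I'))
    ... | no  i∉I  = ⊥-elim (i∉I i∈I)
    eℕ : Fin n → ℕ
    eℕ l = ∑ (λ i → toℕ (c i) * toℕ (d i l))
    e : Fin n → Fin q
    e l = reduce (eℕ l)
    suppB : SupportedOn e B
    suppB l el≢0 with l ∈? B
    ... | yes l∈B = l∈B
    ... | no  l∉B = ⊥-elim (el≢0 (≈0⇒reduce≡0 (eℕ l) (≡⇒≈ (∑-zero (λ i →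
      trans (cong (toℕ (c i) *_) (outside-support (d-supp i) l∉B)) (*-zeroʳ (toℕ (c i))))))))
    term≈ : ∀ j i → toℕ (c i) * W' i j ≈ toℕ (c i) * combination (λ l → toℕ (d i l)) W j
    term≈ j i with toℕ≟0 (c i)
    ... | yes ci≡0 = ≡⇒≈ (trans (cong (_* W' i j) ci≡0) (sym (cong (_* combination (λ l → toℕ (d i l)) W j) ci≡0)))
    ... | no  ci≢0 = *-congˡ (toℕ (c i)) (W'≈ i (supp i ci≢0) j)
    v≈' : ∀ j → v j ≈ combination (λ l → toℕ (e l)) W j
    v≈' j = begin
      v j                                                              ≈⟨ v≈ j ⟩
      ∑ (λ i → toℕ (c i) * W' i j)                                     ≈⟨ ∑-cong-≈ (term≈ j) ⟩
      ∑ (λ i → toℕ (c i) * combination (λ l → toℕ (d i l)) W j)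
        ≡⟨ ∑-assoc-matrix (λ i → toℕ (c i)) (λ i l → toℕ (d i l)) (λ l → W l j) ⟩
      ∑ (λ l → eℕ l * W l j)
        ≈⟨ ∑-cong-≈ (λ l → *-cong (≈-sym (reduce-≈ (eℕ l))) (≈-refl {W l j})) ⟩
      combination (λ l → toℕ (e l)) W j                                ∎
      where open ≈-Reasoning

  dependent-image-enum⇒ : ∀ {n t} (W : Fin n → Fin t → ℕ) (F : Subset n) (X : Subset ∣ F ∣) →
    DependentIn W (image (enum F) X) → DependentIn (λ l → W (enum F l)) X
  dependent-image-enum⇒ W F X (c , supp , (i₀ , ci₀≢0) , sums) = (λ l → c (enum F l)) , supp' , nonzero' , sums'
    where
    supp' : SupportedOn (λ l → c (enum F l)) X
    supp' l cl≢0 with ∈-image⁻ (enum F) X (supp (enum F l) cl≢0)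
    ... | j , j∈X , e = subst (_∈ X) (enum-injective F e) j∈X
    nonzero' : ∃ λ l → toℕ (c (enum F l)) ≢ 0
    nonzero' with ∈-image⁻ (enum F) X (supp i₀ ci₀≢0)
    ... | j , _ , refl = j , ci₀≢0
    sums' : ∀ j → q ∣ combination (λ l → toℕ (c (enum F l))) (λ l → W (enum F l)) j
    sums' j = subst (q ∣_) (∑-enum F (λ i → toℕ (c i) * W i j) outside≡0) (sums j)
      where
      outside≡0 : ∀ i → i ∉ F → toℕ (c i) * W i j ≡ 0
      outside≡0 i i∉F = cong (_* W i j) (outside-support supp (λ i∈ → i∉F (image⊆F i∈)))
        where
        image⊆F : ∀ {i} → i ∈ image (enum F) X → i ∈ F
        image⊆F p with ∈-image⁻ (enum F) X p
        ... | j , _ , refl = enum-∈ F j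

  dependent-enum⇒image : ∀ {n t} (W : Fin n → Fin t → ℕ) (F : Subset n) (X : Subset ∣ F ∣) →
    DependentIn (λ l → W (enum F l)) X → DependentIn W (image (enum F) X)
  dependent-enum⇒image {n} W F X (c' , supp' , (l₀ , c'l₀≢0) , sums) = c , supp , (enum F l₀ , cl₀≢0) , sums'
    where
    c : Fin n → Fin q
    c = extend F c' (reduce 0)
    c-∉ : ∀ i → i ∉ F → toℕ (c i) ≡ 0
    c-∉ i i∉F = trans (cong toℕ (extend-∉ F c' (reduce 0) i i∉F)) reduce-0
    supp : SupportedOn c (image (enum F) X)
    supp i ci≢0 with i ∈? F
    ... | no i∉F = ⊥-elim (ci≢0 (c-∉ i i∉F))
    ... | yes i∈F with ∈⇒∈-enum F i∈F
    ... | l , refl = ∈-image⁺ (enum F) X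
                       (supp' l (λ c'l≡0 → ci≢0 (trans (cong toℕ (extend-enum F c' (reduce 0) l)) c'l≡0)))
    cl₀≢0 : toℕ (c (enum F l₀)) ≢ 0
    cl₀≢0 cl₀≡0 = c'l₀≢0 (trans (cong toℕ (sym (extend-enum F c' (reduce 0) l₀))) cl₀≡0)
    sums' : ∀ j → q ∣ combination (λ i → toℕ (c i)) W j
    sums' j = subst (q ∣_) (sym (trans (∑-enum F (λ i → toℕ (c i) * W i j) (λ i i∉F → cong (_* W i j) (c-∉ i i∉F)))
                                       (∑-cong (λ l → cong (λ z → toℕ z * W (enum F l) j)
                                                           (extend-enum F c' (reduce 0) l)))))
                    (sums j)

  dependent-enum : ∀ {n t} (W : Fin n → Fin t → ℕ) (F : Subset n) (X : Subset ∣ F ∣) →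
    DependentIn W (image (enum F) X) ⇔ DependentIn (λ l → W (enum F l)) X
  dependent-enum W F X = mk⇔ (dependent-image-enum⇒ W F X) (dependent-enum⇒image W F X)

  module Coordinates {n t} (W : Fin n → Fin t → ℕ) (B : Subset n) (B-indep : ¬ DependentIn W B) where

    k : ℕ
    k = ∣ B ∣

    basis : Fin k → Fin t → ℕ
    basis l = W (enum B l)

    fromCoordinates : (Fin k → ℕ) → Fin t → ℕ
    fromCoordinates a = combination a basis

    combination-enum : (c : Fin n → Fin q) → SupportedOn c B → ∀ j →
      combination (λ i → toℕ (c i)) W j ≡ fromCoordinates (λ l → toℕ (c (enum B l))) j
    combination-enum c supp j =
      ∑-enum B (λ i → toℕ (c i) * W i j) (λ i i∉B → cong (_* W i j) (outside-support supp i∉B))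

    InSpan⇒coordinates : ∀ {v} → InSpan W B v → Σ (Fin k → Fin q) λ a → ∀ j → v j ≈ fromCoordinates (λ l → toℕ (a l)) j
    InSpan⇒coordinates (c , supp , v≈) = (λ l → c (enum B l)) , λ j → trans (v≈ j) (cong (_% q) (combination-enum c supp j))

    fromCoordinates-cong : ∀ {a a'} → (∀ l → a l ≈ a' l) → ∀ j → fromCoordinates a j ≈ fromCoordinates a' j
    fromCoordinates-cong a≈a' j = ∑-cong-≈ (λ l → *-cong (a≈a' l) (≈-refl {basis l j}))

    fromCoordinates-≈0 : ∀ {a} → (∀ l → a l ≈ 0) → ∀ j → fromCoordinates a j ≈ 0
    fromCoordinates-≈0 a≈0 j = ≈-trans (fromCoordinates-cong a≈0 j) (≡⇒≈ (∑-zero {f = λ l → 0 * basis l j} (λ l → refl)))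

    fromCoordinates-+ : ∀ x y a b j →
      fromCoordinates (λ l → x * a l + y * b l) j ≡ x * fromCoordinates a j + y * fromCoordinates b j
    fromCoordinates-+ x y a b j = begin
      ∑ (λ l → (x * a l + y * b l) * basis l j)
        ≡⟨ ∑-cong (λ l → distrib x y (a l) (b l) (basis l j)) ⟩
      ∑ (λ l → x * (a l * basis l j) + y * (b l * basis l j))
        ≡⟨ ∑-distrib-+ (λ l → x * (a l * basis l j)) _ ⟩
      ∑ (λ l → x * (a l * basis l j)) + ∑ (λ l → y * (b l * basis l j))
        ≡⟨ cong₂ _+_ (∑-*ˡ x (λ l → a l * basis l j)) (∑-*ˡ y (λ l → b l * basis l j)) ⟩
      x * fromCoordinates a j + y * fromCoordinates b j
        ∎
      where
      open ≡-Reasoning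
      distrib : ∀ x y c d w → (x * c + y * d) * w ≡ x * (c * w) + y * (d * w)
      distrib = solve-∀

    fromCoordinates-* : ∀ x a j → x * fromCoordinates a j ≡ fromCoordinates (λ l → x * a l) j
    fromCoordinates-* x a j =
      trans (sym (∑-*ˡ x (λ l → a l * basis l j))) (∑-cong (λ l → sym (*-assoc x (a l) (basis l j))))

    liftCoefficients : (Fin k → ℕ) → Fin n → Fin q
    liftCoefficients a = extend B (λ l → reduce (a l)) (reduce 0)

    liftCoefficients-supported : ∀ a → SupportedOn (liftCoefficients a) B
    liftCoefficients-supported a i ci≢0 with i ∈? B
    ... | yes i∈B = i∈B
    ... | no  i∉B = ⊥-elim (ci≢0 (trans (cong toℕ (extend-∉ B (λ l → reduce (a l)) (reduce 0) i i∉B)) reduce-0))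

    combination-liftCoefficients : ∀ a j → combination (λ i → toℕ (liftCoefficients a i)) W j ≈ fromCoordinates a j
    combination-liftCoefficients a j = ≈-trans
      (≡⇒≈ (trans (combination-enum (liftCoefficients a) (liftCoefficients-supported a) j)
                  (∑-cong (λ l → cong (λ z → toℕ z * basis l j) (extend-enum B (λ l → reduce (a l)) (reduce 0) l)))))
      (fromCoordinates-cong (λ l → reduce-≈ (a l)) j)

    coordinates⇒InSpan : ∀ {v} (a : Fin k → ℕ) → (∀ j → v j ≈ fromCoordinates a j) → InSpan W B v
    coordinates⇒InSpan a v≈ =
      liftCoefficients a , liftCoefficients-supported a , λ j → ≈-trans (v≈ j) (≈-sym (combination-liftCoefficients a j))

    fromCoordinates-≈0⇒≈0 : ∀ (a : Fin k → ℕ) → (∀ j → fromCoordinates a j ≈ 0) → ∀ l → a l ≈ 0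
    fromCoordinates-≈0⇒≈0 a a≈0 l₀ with (a l₀ % q) ≟ℕ (0 % q)
    ... | yes al₀≈0 = al₀≈0
    ... | no  al₀≉0 = ⊥-elim (B-indep (liftCoefficients a , liftCoefficients-supported a , (enum B l₀ , cl₀≢0) ,
                                      λ j → ≈0⇒∣ (≈-trans (combination-liftCoefficients a j) (a≈0 j))))
      where
      cl₀≢0 : toℕ (liftCoefficients a (enum B l₀)) ≢ 0
      cl₀≢0 cl₀≡0 = al₀≉0 (≈-trans (≈-sym (reduce-≈ (a l₀)))
        (≡⇒≈ (trans (cong toℕ (sym (extend-enum B (λ l → reduce (a l)) (reduce 0) l₀))) cl₀≡0)))

    fromCoordinates-injective : ∀ (a a' : Fin k → ℕ) → (∀ j → fromCoordinates a j ≈ fromCoordinates a' j) → ∀ l → a l ≈ a' l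
    fromCoordinates-injective a a' a≈a' l =
      x+[q-1]y≈0⇒x≈y (a l) (a' l) (fromCoordinates-≈0⇒≈0 (λ l → a l + q-1 * a' l) difference≈0 l)
      where
      difference≈0 : ∀ j → fromCoordinates (λ l → a l + q-1 * a' l) j ≈ 0
      difference≈0 j = begin
        fromCoordinates (λ l → a l + q-1 * a' l) j
                                                         ≡⟨ ∑-cong (λ l → cong (λ z → (z + q-1 * a' l) * basis l j)
                                                                               (sym (*-identityˡ (a l)))) ⟩
        fromCoordinates (λ l → 1 * a l + q-1 * a' l) j   ≡⟨ fromCoordinates-+ 1 q-1 a a' j ⟩
        1 * fromCoordinates a j + q-1 * fromCoordinates a' j
                                                         ≈⟨ +-cong (*-congˡ 1 (a≈a' j)) (≈-refl {q-1 * fromCoordinates a' j}) ⟩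
        1 * fromCoordinates a' j + q-1 * fromCoordinates a' j ≡⟨ swap (fromCoordinates a' j) q-1 ⟩
        q-1 * fromCoordinates a' j + fromCoordinates a' j ≈⟨ [q-1]y+y≈0 (fromCoordinates a' j) ⟩
        0                                                ∎
        where
        open ≈-Reasoning
        swap : ∀ x r → 1 * x + r * x ≡ r * x + x
        swap = solve-∀

    dependent-coordinates : ∀ {m} (u : Fin m → Fin t → ℕ) (A : Fin m → Fin k → ℕ) →
      (∀ i j → u i j ≈ fromCoordinates (A i) j) → ∀ X → DependentIn u X ⇔ DependentIn A X
    dependent-coordinates u A u≈ X = mk⇔ toCoordinates fromCoordinates'
      where
      ∑-fromCoordinates : ∀ (c : Fin _ → ℕ) j →
        ∑ (λ i → c i * fromCoordinates (A i) j) ≡ fromCoordinates (λ l → combination c A l) j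
      ∑-fromCoordinates c j = ∑-assoc-matrix c A (λ l → basis l j)
      ∑u≈ : ∀ (c : Fin _ → ℕ) j → combination c u j ≈ fromCoordinates (λ l → combination c A l) j
      ∑u≈ c j = ≈-trans (∑-cong-≈ (λ i → *-congˡ (c i) (u≈ i j))) (≡⇒≈ (∑-fromCoordinates c j))
      toCoordinates : DependentIn u X → DependentIn A X
      toCoordinates (c , supp , nonzero , sums) = c , supp , nonzero , λ l → ≈0⇒∣
        (fromCoordinates-≈0⇒≈0 (λ l → combination (λ i → toℕ (c i)) A l)
                              (λ j → ≈-trans (≈-sym (∑u≈ (λ i → toℕ (c i)) j)) (∣⇒≈0 (sums j))) l)
      fromCoordinates' : DependentIn A X → DependentIn u X
      fromCoordinates' (c , supp , nonzero , sums) = c , supp , nonzero , λ j → ≈0⇒∣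
        (≈-trans (∑u≈ (λ i → toℕ (c i)) j) (fromCoordinates-≈0 (λ l → ∣⇒≈0 (sums l)) j))

    NonzeroVec-coordinates : (v : Vecq q t) (a : Vecq q k) → (∀ j → toℕ (v j) ≈ fromCoordinates (λ l → toℕ (a l)) j) →
      NonzeroVec v → NonzeroVec a
    NonzeroVec-coordinates v a v≈ (j , vj≢0) with any? (λ l → ¬? (toℕ≟0 (a l)))
    ... | yes a≢0 = a≢0
    ... | no  a≡0 = ⊥-elim (vj≢0 (toℕ≈0⇒≡0 (v j) (≈-trans (v≈ j) (≡⇒≈ (∑-zero (λ l → cong (_* basis l j) (al≡0 l)))))))
      where
      al≡0 : ∀ l → toℕ (a l) ≡ 0
      al≡0 l with toℕ≟0 (a l)
      ... | yes al≡0' = al≡0'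
      ... | no  al≢0  = ⊥-elim (a≡0 (l , al≢0))

    Parallel-coordinates : (u u' : Vecq q t) (a a' : Vecq q k) →
      (∀ j → toℕ (u j) ≈ fromCoordinates (λ l → toℕ (a l)) j) → (∀ j → toℕ (u' j) ≈ fromCoordinates (λ l → toℕ (a' l)) j) →
      Parallel q a a' → Parallel q u u'
    Parallel-coordinates u u' a a' u≈ u'≈ (c , c≢0 , a∥a') = c , c≢0 , λ j → ≈0⇒∣ (begin
      toℕ c * toℕ (u j) + q-1 * toℕ (u' j)
        ≈⟨ +-cong (*-congˡ (toℕ c) (u≈ j)) (*-congˡ q-1 (u'≈ j)) ⟩
      toℕ c * fromCoordinates (λ l → toℕ (a l)) j + q-1 * fromCoordinates (λ l → toℕ (a' l)) j
        ≡⟨ sym (fromCoordinates-+ (toℕ c) q-1 (λ l → toℕ (a l)) (λ l → toℕ (a' l)) j) ⟩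
      fromCoordinates (λ l → toℕ c * toℕ (a l) + q-1 * toℕ (a' l)) j
        ≈⟨ fromCoordinates-≈0 (λ l → ∣⇒≈0 (a∥a' l)) j ⟩
      0 ∎)
      where open ≈-Reasoning

    embed : Vecq q k → Vecq q t
    embed v j = reduce (fromCoordinates (λ l → toℕ (v l)) j)

    embed-nonzero : (v : Vecq q k) → NonzeroVec v → NonzeroVec (embed v)
    embed-nonzero v (l₀ , vl₀≢0) with any? (λ j → ¬? (toℕ≟0 (embed v j)))
    ... | yes embed≢0 = embed≢0
    ... | no  embed≡0 = ⊥-elim (vl₀≢0 (toℕ≈0⇒≡0 (v l₀) (fromCoordinates-≈0⇒≈0 (λ l → toℕ (v l)) embed≈0 l₀)))
      where
      embed≈0 : ∀ j → fromCoordinates (λ l → toℕ (v l)) j ≈ 0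
      embed≈0 j with toℕ≟0 (embed v j)
      ... | yes ej≡0 = ≈-trans (≈-sym (reduce-≈ _)) (≡⇒≈ ej≡0)
      ... | no  ej≢0 = ⊥-elim (embed≡0 (j , ej≢0))

    Parallel-embed : (u : Vecq q t) (v : Vecq q k) → Parallel q u (embed v) →
      Σ (Fin q) λ c → toℕ c ≢ 0 × (∀ j → toℕ (u j) ≈ fromCoordinates (λ l → toℕ c * toℕ (v l)) j)
    Parallel-embed u v (c , c≢0 , u∥v) = c , c≢0 , λ j →
      ≈-trans (c*x+[q-1]y≈0⇒x≈c*y c c≢0 (toℕ (u j)) _ (∣⇒≈0 (u∥v j)))
              (≈-trans (*-congˡ (toℕ c) (reduce-≈ _)) (≡⇒≈ (fromCoordinates-* (toℕ c) (λ l → toℕ (v l)) j)))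

    coordinates-Parallel : (u : Vecq q t) (a v : Vecq q k) (c : Fin q) → toℕ c ≢ 0 →
      (∀ j → toℕ (u j) ≈ fromCoordinates (λ l → toℕ (a l)) j) →
      (∀ j → toℕ (u j) ≈ fromCoordinates (λ l → toℕ c * toℕ (v l)) j) → Parallel q a v
    coordinates-Parallel u a v c c≢0 u≈a u≈cv = c , c≢0 , λ l → ≈0⇒∣ (begin
      toℕ c * toℕ (a l) + q-1 * toℕ (v l)              ≈⟨ +-cong (*-congˡ (toℕ c) (a≈cv l)) (≈-refl {q-1 * toℕ (v l)}) ⟩
      toℕ c * (toℕ c * toℕ (v l)) + q-1 * toℕ (v l)    ≡⟨ reassociate (toℕ c) (toℕ (v l)) q-1 ⟩
      toℕ c * toℕ c * toℕ (v l) + q-1 * toℕ (v l)      ≈⟨ +-cong (*-cong (c*c≈1 c c≢0) (≈-refl {toℕ (v l)}))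
                                                                 (≈-refl {q-1 * toℕ (v l)}) ⟩
      1 * toℕ (v l) + q-1 * toℕ (v l)                  ≡⟨ swap (toℕ (v l)) q-1 ⟩
      q-1 * toℕ (v l) + toℕ (v l)                      ≈⟨ [q-1]y+y≈0 (toℕ (v l)) ⟩
      0                                                ∎)
      where
      open ≈-Reasoning
      a≈cv : ∀ l → toℕ (a l) ≈ toℕ c * toℕ (v l)
      a≈cv = fromCoordinates-injective (λ l → toℕ (a l)) (λ l → toℕ c * toℕ (v l))
                                       (λ j → ≈-trans (≈-sym (u≈a j)) (u≈cv j))
      reassociate : ∀ c v r → c * (c * v) + r * v ≡ c * c * v + r * v
      reassociate = solve-∀
      swap : ∀ v r → 1 * v + r * v ≡ r * v + v
      swap = solve-∀

    Represents-restriction : ∀ {p} {P : Matroid p} (e : Fin p → Vecq q t) → Represents q P t e →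
      (S : Subset p) (e' : Fin ∣ S ∣ → Vecq q k) →
      (∀ j i → toℕ (e (enum S j) i) ≈ fromCoordinates (λ l → toℕ (e' j l)) i) →
      Represents q (restriction P S) k e'
    Represents-restriction {p} e (nonzero , nonparallel , P-ind) S e' e≈ =
      (λ j → NonzeroVec-coordinates (e (enum S j)) (e' j) (e≈ j) (nonzero (enum S j))) ,
      (λ i j i≢j e'i∥e'j → nonparallel (enum S i) (enum S j) (λ e → i≢j (enum-injective S e))
         (Parallel-coordinates (e (enum S i)) (e (enum S j)) (e' i) (e' j) (e≈ i) (e≈ j) e'i∥e'j)) ,
      λ X → mk⇔ (λ ind dep → to (P-ind _) ind (from (dependent-enum W' S X) (from (dependent X) dep)))
                (λ indep → from (P-ind _) (λ dep → indep (to (dependent X) (to (dependent-enum W' S X) dep))))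
      where
      W' : Fin p → Fin t → ℕ
      W' i j = toℕ (e i j)
      dependent : ∀ X → DependentIn (λ j → W' (enum S j)) X ⇔ DependentIn (λ j l → toℕ (e' j l)) X
      dependent = dependent-coordinates (λ j → W' (enum S j)) (λ j l → toℕ (e' j l)) e≈

-- The complement step

module Complement (q : ℕ) {{_ : NonZero q}} (1<q : 1 < q)
  (c*c≡1 : ∀ (c : Fin q) → toℕ c ≢ 0 → (toℕ c * toℕ c) % q ≡ 1)
  {m n} {M : Matroid m} (t : ℕ) (eM : Fin m → Vecq q t) (M-rep : Represents q M t eM)
  (N : Matroid n) (eN : Fin n → Vecq q t) (N-rep : Represents q N t eN)
  (M∦N : ∀ i j → ¬ Parallel q (eM i) (eN j))
  (M∪N : ∀ (v : Vecq q t) → NonzeroVec v → (∃ λ i → Parallel q (eM i) v) ⊎ (∃ λ j → Parallel q (eN j) v))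
  (F : Subset n) (F-flat : IsFlat N F) where

  open LinearAlgebra q 1<q c*c≡1

  WN : Fin n → Fin t → ℕ
  WN i j = toℕ (eN i j)

  WM : Fin m → Fin t → ℕ
  WM i j = toℕ (eM i j)

  N-ind : ∀ X → Ind N X ⇔ (¬ DependentIn WN X)
  N-ind = proj₂ (proj₂ N-rep)

  M-ind : ∀ X → Ind M X ⇔ (¬ DependentIn WM X)
  M-ind = proj₂ (proj₂ M-rep)

  open Span WN using (InSpan?; ∈⇒InSpan; InSpan⇒dependent; dependent⇒InSpan)

  extendable? : ∀ B y → Ind N B → y ∉ B → Dec (Ind N (⁅ y ⁆ ∪ B))
  extendable? B y indB y∉B with InSpan? B (WN y)
  ... | yes y∈span = no (λ ind → to (N-ind _) ind (InSpan⇒dependent y∉B y∈span))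
  ... | no  y∉span = yes (from (N-ind _) (λ dep → y∉span (dependent⇒InSpan (to (N-ind B) indB) dep)))

  basis-of-F : Σ (Subset n) (MaximalIndependentIn N F)
  basis-of-F = Greedy.maximalIndependent N (λ A → A) (λ a → a) (λ a f → f a) extendable? F

  abstract
    B : Subset n
    B = proj₁ basis-of-F

    B⊆F : B ⊆ F
    B⊆F = proj₁ (proj₂ basis-of-F)

    B-ind : Ind N B
    B-ind = proj₁ (proj₂ (proj₂ basis-of-F))

    B-maximal : ∀ y → y ∈ F → y ∉ B → ¬ Ind N (⁅ y ⁆ ∪ B)
    B-maximal = proj₂ (proj₂ (proj₂ basis-of-F))

  B-indep : ¬ DependentIn WN B
  B-indep = to (N-ind B) B-ind

  abstract
    F⊆span : ∀ y → y ∈ F → InSpan WN B (WN y)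
    F⊆span y y∈F with y ∈? B
    ... | yes y∈B = ∈⇒InSpan y∈B
    ... | no  y∉B with InSpan? B (WN y)
    ... | yes y∈span = y∈span
    ... | no  y∉span = ⊥-elim (B-maximal y y∈F y∉B (from (N-ind _) (λ dep → y∉span (dependent⇒InSpan B-indep dep))))

  RankIs-spanned : ∀ Z → B ⊆ Z → (∀ y → y ∈ Z → InSpan WN B (WN y)) → RankIs N Z ∣ B ∣
  RankIs-spanned Z B⊆Z Z⊆span = maximalIndependent⇒RankIs N (B⊆Z , B-ind ,
    λ y y∈Z y∉B ind → to (N-ind _) ind (InSpan⇒dependent y∉B (Z⊆span y y∈Z)))

  span⊆F : ∀ j → InSpan WN B (WN j) → j ∈ F
  span⊆F j j∈span with j ∈? F
  ... | yes j∈F = j∈F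
  ... | no  j∉F = ⊥-elim (F-flat j j∉F ∣ B ∣ (RankIs-spanned F B⊆F F⊆span)
                                              (RankIs-spanned (⁅ j ⁆ ∪ F) (λ p → q⊆p∪q ⁅ j ⁆ F (B⊆F p)) jF⊆span))
    where
    jF⊆span : ∀ y → y ∈ ⁅ j ⁆ ∪ F → InSpan WN B (WN y)
    jF⊆span y p with x∈p∪q⁻ ⁅ j ⁆ F p
    ... | inj₁ y∈⁅j⁆ = subst (λ z → InSpan WN B (WN z)) (sym (x∈⁅y⁆⇒x≡y j y∈⁅j⁆)) j∈span
    ... | inj₂ y∈F   = F⊆span y y∈F

  open Coordinates WN B B-indep

  G : Subset m
  G = subset (λ i → InSpan? B (WM i))

  G⊆span : ∀ {i} → i ∈ G → InSpan WN B (WM i)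
  G⊆span = ∈-subset⁻ (λ i → InSpan? B (WM i))

  span⊆G : ∀ {i} → InSpan WN B (WM i) → i ∈ G
  span⊆G = ∈-subset⁺ (λ i → InSpan? B (WM i))

  G-flat : IsFlat M G
  G-flat x x∉G r ((I , I⊆G , indI , ∣I∣≡r) , _) (_ , bound') =
    n≮n r (subst (_≤ r) (trans (∣⁅x⁆∪p∣≡1+∣p∣ x I x∉I) (cong suc ∣I∣≡r))
                        (bound' (⁅ x ⁆ ∪ I) (⁅y⁆∪-mono x I⊆G) indxI))
    where
    x∉I : x ∉ I
    x∉I x∈I = x∉G (I⊆G x∈I)
    indxI : Ind M (⁅ x ⁆ ∪ I)
    indxI = from (M-ind _) (λ dep → x∉G (span⊆G
      (InSpan-trans WN WM (Span.dependent⇒InSpan WM (to (M-ind I) indI) dep) (λ i i∈I → G⊆span (I⊆G i∈I)))))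

  abstract
    eF : Fin ∣ F ∣ → Vecq q k
    eF j = proj₁ (InSpan⇒coordinates (F⊆span (enum F j) (enum-∈ F j)))

    eF≈ : ∀ j i → WN (enum F j) i ≈ fromCoordinates (λ l → toℕ (eF j l)) i
    eF≈ j = proj₂ (InSpan⇒coordinates (F⊆span (enum F j) (enum-∈ F j)))

    eG : Fin ∣ G ∣ → Vecq q k
    eG j = proj₁ (InSpan⇒coordinates (G⊆span (enum-∈ G j)))

    eG≈ : ∀ j i → WM (enum G j) i ≈ fromCoordinates (λ l → toℕ (eG j l)) i
    eG≈ j = proj₂ (InSpan⇒coordinates (G⊆span (enum-∈ G j)))

  G∦F : ∀ i j → ¬ Parallel q (eG i) (eF j)
  G∦F i j eGi∥eFj = M∦N (enum G i) (enum F j)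
    (Parallel-coordinates (eM (enum G i)) (eN (enum F j)) (eG i) (eF j) (eG≈ i) (eF≈ j) eGi∥eFj)

  G∪F : ∀ (v : Vecq q k) → NonzeroVec v → (∃ λ i → Parallel q (eG i) v) ⊎ (∃ λ j → Parallel q (eF j) v)
  G∪F v v≢0 with M∪N (embed v) (embed-nonzero v v≢0)
  ... | inj₁ (i , eMi∥v) with Parallel-embed (eM i) v eMi∥v
  ...   | c , c≢0 , eMi≈cv with ∈⇒∈-enum G (span⊆G (coordinates⇒InSpan (λ l → toℕ c * toℕ (v l)) eMi≈cv))
  ...     | i' , refl = inj₁ (i' , coordinates-Parallel (eM (enum G i')) (eG i') v c c≢0 (eG≈ i') eMi≈cv)
  G∪F v v≢0 | inj₂ (j , eNj∥v) with Parallel-embed (eN j) v eNj∥v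
  ...   | c , c≢0 , eNj≈cv with ∈⇒∈-enum F (span⊆F j (coordinates⇒InSpan (λ l → toℕ c * toℕ (v l)) eNj≈cv))
  ...     | j' , refl = inj₂ (j' , coordinates-Parallel (eN (enum F j')) (eF j') v c c≢0 (eF≈ j') eNj≈cv)

  restriction-complement : IsComatroid q (restriction M G) → IsComatroid q (restriction N F)
  restriction-complement M|G-comatroid =
    compl M|G-comatroid k eG (Represents-restriction {P = M} eM M-rep G eG eG≈)
          (restriction N F) eF (Represents-restriction {P = N} eN N-rep F eF eF≈) G∦F G∪F

module _ (q : ℕ) {{_ : NonZero q}} (1<q : 1 < q)
  (c*c≡1 : ∀ (c : Fin q) → toℕ c ≢ 0 → (toℕ c * toℕ c) % q ≡ 1) where

  restriction-IsComatroid : ∀ {n} {M : Matroid n} → IsComatroid q M → (F : Subset n) → IsFlat M F →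
                            IsComatroid q (restriction M F)
  restriction-IsComatroid (empty M) [] _ = empty (restriction M [])
  restriction-IsComatroid (iso {M = M} {N = N} M-comatroid N≅M) F F-flat =
    iso (restriction-IsComatroid M-comatroid (image (proj₁ N≅M) F) (T.IsFlat-image F-flat)) (T.restriction-≅ F)
    where module T = Transport {N = N} {M = M} N≅M
  restriction-IsComatroid (dsum {m} {m'} {M₁} {M₂} M₁-comatroid M₂-comatroid N N-ind) F F-flat =
    subst (λ Z → IsComatroid q (restriction N Z)) (take++drop≡id m F)
      (D.restriction-++-IsComatroid F₁ F₂ (restriction-IsComatroid M₁-comatroid F₁ (D.IsFlat-++ˡ F₁₂-flat))
                                          (restriction-IsComatroid M₂-comatroid F₂ (D.IsFlat-++ʳ F₁₂-flat)))
    where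
    module D = DirectSum {M₁ = M₁} {M₂ = M₂} N N-ind
    F₁ : Subset m
    F₁ = take m F
    F₂ : Subset m'
    F₂ = drop m F
    F₁₂-flat : IsFlat N (F₁ ++ F₂)
    F₁₂-flat = subst (IsFlat N) (sym (take++drop≡id m F)) F-flat
  restriction-IsComatroid (compl M-comatroid t eM M-rep N eN N-rep M∦N M∪N) F F-flat =
    C.restriction-complement (restriction-IsComatroid M-comatroid C.G C.G-flat)
    where module C = Complement q 1<q c*c≡1 t eM M-rep N eN N-rep M∦N M∪N F F-flat

c*c≡1-GF2 : ∀ (c : Fin 2) → toℕ c ≢ 0 → (toℕ c * toℕ c) % 2 ≡ 1
c*c≡1-GF2 zero       c≢0 = ⊥-elim (c≢0 refl)
c*c≡1-GF2 (suc zero) c≢0 = refl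

c*c≡1-GF3 : ∀ (c : Fin 3) → toℕ c ≢ 0 → (toℕ c * toℕ c) % 3 ≡ 1
c*c≡1-GF3 zero             c≢0 = ⊥-elim (c≢0 refl)
c*c≡1-GF3 (suc zero)       c≢0 = refl
c*c≡1-GF3 (suc (suc zero)) c≢0 = refl

lemma2p7 : (q : ℕ) → (q ≡ 2 ⊎ q ≡ 3) →
    ∀ {n} (M : Matroid n) → IsComatroid q M →
    (F : Subset n) → IsFlat M F →
    Σ ℕ λ m → Σ (Matroid m) λ N → IsRestrictionOf N M F × IsComatroid q N
lemma2p7 .2 (inj₁ refl) M M-comatroid F F-flat =
  ∣ F ∣ , restriction M F , restriction-IsRestrictionOf M F ,
  restriction-IsComatroid 2 (s≤s (s≤s z≤n)) c*c≡1-GF2 M-comatroid F F-flat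
lemma2p7 .3 (inj₂ refl) M M-comatroid F F-flat =
  ∣ F ∣ , restriction M F , restriction-IsRestrictionOf M F ,
  restriction-IsComatroid 3 (s≤s (s≤s z≤n)) c*c≡1-GF3 M-comatroid F F-flat
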